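{- Let $\mathbb{F}$ be a field and $f\in\mathbb{F}[x_1,x_2,\ldots]$. Suppose some matrix $F\in Q(f)+\mathcal{O}(\varepsilon^3)$ can be written as a product of $n$ primitive Q-matrices. Then some matrix $H\in Q(f^2)+\mathcal{O}(\varepsilon)$ and some matrix $H'\in Q(-f^2)+\mathcal{O}(\varepsilon)$ can each be written as a product of $2n+11$ primitive Q-matrices. Moreover, if the error degree of $F$ is $e_f$, then the error degrees of $H$ and $H'$ are at most $2e_f+4$.
   Context: $\varepsilon$ is a formal variable. For a polynomial $h$ over $\mathbb{F}(\varepsilon)$, $Q(h)=\begin{pmatrix} h & 1\\ 1 & 0\end{pmatrix}$. A parametrized affine linear form is an affine linear form in the variables $x_1,x_2,\ldots$ with coefficients in $\mathbb{F}(\varepsilon)$; a primitive Q-matrix is a matrix $Q(\ell)$ with $\ell$ a parametrized affine linear form. $\mathcal{O}(\varepsilon^k)$ denotes the set $\varepsilon^k\,\mathbb{F}[\varepsilon,x_1,x_2,\ldots]$, and for a $2\times 2$ matrix $M$, $M+\mathcal{O}(\varepsilon^k)$ denotes the set of matrices $M+E$ with all four entries of $E$ in $\mathcal{O}(\varepsilon^k)$. The error degree of a matrix with entries in $\mathbb{F}[\varepsilon,x_1,x_2,\ldots]$ is the largest power of $\varepsilon$ occurring in its entries. -}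

module Defs where

open import Level using (Level; _⊔_; suc)
open import Algebra.Bundles using (CommutativeRing)
open import Data.Nat as ℕ using (ℕ; zero)
open import Data.Fin using (Fin; toℕ)
open import Data.Unit using (⊤; tt)
open import Data.List using (List; []; _∷_)
open import Data.Vec using (Vec; []; _∷_; lookup)
open import Data.Product using (Σ; ∃; _×_; _,_; proj₁; proj₂)
open import Relation.Nullary using (¬_)

record Field (c ℓ : Level) : Set (suc (c ⊔ ℓ)) where
  field
    commutativeRing : CommutativeRing c ℓ
  open CommutativeRing commutativeRing public
  field
    0≉1     : ¬ (0# ≈ 1#)
    inverse : ∀ x → ¬ (x ≈ 0#) → ∃ λ y → (x * y) ≈ 1#

module Over {c ℓ : Level} (𝔽 : Field c ℓ) where
  open Field 𝔽 using (_≈_; 0#; 1#; _+_; _*_) renaming (Carrier to K)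

  infixl 6 _⊕_
  infixl 7 _⊗_

  data Term (V : Set) : Set c where
    con  : K → Term V
    var  : V → Term V
    _⊕_  : Term V → Term V → Term V
    _⊗_  : Term V → Term V → Term V
    ⊝_   : Term V → Term V

  -- Equality of polynomials: the least congruence making Term V a
  -- commutative ring in which  con : 𝔽 → Term V  is a ring homomorphism.
  -- Hence Term V / ≃ is the free commutative 𝔽-algebra on V, i.e. the
  -- polynomial ring 𝔽[V].
  infix 4 _≃_
  data _≃_ {V : Set} : Term V → Term V → Set (c ⊔ ℓ) where
    ≃-refl  : ∀ {p} → p ≃ p
    ≃-sym   : ∀ {p q} → p ≃ q → q ≃ p
    ≃-trans : ∀ {p q r} → p ≃ q → q ≃ r → p ≃ r
    ⊕-cong  : ∀ {p p' q q'} → p ≃ p' → q ≃ q' → p ⊕ q ≃ p' ⊕ q'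
    ⊗-cong  : ∀ {p p' q q'} → p ≃ p' → q ≃ q' → p ⊗ q ≃ p' ⊗ q'
    ⊝-cong  : ∀ {p q} → p ≃ q → ⊝ p ≃ ⊝ q
    ⊕-assoc : ∀ p q r → (p ⊕ q) ⊕ r ≃ p ⊕ (q ⊕ r)
    ⊕-comm  : ∀ p q → p ⊕ q ≃ q ⊕ p
    ⊕-idʳ   : ∀ p → p ⊕ con 0# ≃ p
    ⊕-invʳ  : ∀ p → p ⊕ (⊝ p) ≃ con 0#
    ⊗-assoc : ∀ p q r → (p ⊗ q) ⊗ r ≃ p ⊗ (q ⊗ r)
    ⊗-comm  : ∀ p q → p ⊗ q ≃ q ⊗ p
    ⊗-idʳ   : ∀ p → p ⊗ con 1# ≃ p
    distribʳ : ∀ p q r → (p ⊕ q) ⊗ r ≃ (p ⊗ r) ⊕ (q ⊗ r)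
    con-cong : ∀ {a b} → a ≈ b → con a ≃ con b
    con-+    : ∀ a b → con (a + b) ≃ con a ⊕ con b
    con-*    : ∀ a b → con (a * b) ≃ con a ⊗ con b

  ren : ∀ {V W : Set} → (V → W) → Term V → Term W
  ren σ (con a) = con a
  ren σ (var v) = var (σ v)
  ren σ (p ⊕ q) = ren σ p ⊕ ren σ q
  ren σ (p ⊗ q) = ren σ p ⊗ ren σ q
  ren σ (⊝ p)   = ⊝ ren σ p

  𝟘 𝟙 : ∀ {V} → Term V
  𝟘 = con 0#
  𝟙 = con 1#

  _^^_ : ∀ {V} → Term V → ℕ → Term V
  p ^^ zero      = 𝟙
  p ^^ ℕ.suc k   = p ⊗ (p ^^ k)

  -- Variables of 𝔽[ε, x₁, x₂, …]:  ε  and  x i  (i : ℕ).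
  data PVar : Set where
    ε : PVar
    x : ℕ → PVar

  P : Set c
  P = Term PVar

  -- 𝔽[x₁, x₂, …]  (variable i stands for x i) and its inclusion into P.
  Px : Set c
  Px = Term ℕ

  ιx : Px → P
  ιx = ren x

  -- 𝔽[ε]  (the unique variable stands for ε) and its inclusion into P.
  Pε : Set c
  Pε = Term ⊤

  ιε : Pε → P
  ιε = ren (λ _ → ε)

  εᴾ : P
  εᴾ = var ε

  -- Elements of 𝔽(ε): quotients a / b with a, b ∈ 𝔽[ε], b ≠ 0.
  record Fε : Set (c ⊔ ℓ) where
    constructor _/_∣_
    field
      num    : Pε
      den    : Pε
      den≠0  : ¬ (den ≃ 𝟘)

  -- Elements of 𝔽(ε)[x₁, x₂, …] are written as fractions p / q with
  -- p ∈ 𝔽[ε,x], q ∈ 𝔽[ε] (embedded in P).  We only need the arithmetic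
  -- on (numerator , denominator) pairs.
  Frac : Set c
  Frac = P × P

  _+ᶠ_ : Frac → Frac → Frac
  (a , b) +ᶠ (c' , d) = (a ⊗ d ⊕ c' ⊗ b , b ⊗ d)

  _*ᶠ_ : Frac → Frac → Frac
  (a , b) *ᶠ (c' , d) = (a ⊗ c' , b ⊗ d)

  0ᶠ 1ᶠ : Frac
  0ᶠ = (𝟘 , 𝟙)
  1ᶠ = (𝟙 , 𝟙)

  ιᶠ : Fε → Frac
  ιᶠ (a / b ∣ _) = (ιε a , ιε b)

  _Equals_ : Frac → P → Set (c ⊔ ℓ)
  (p , q) Equals g = p ≃ q ⊗ g

  -- Parametrized affine linear forms  c₀ + c₁ x₀ + … + c_m x_{m-1}
  -- with coefficients cᵢ ∈ 𝔽(ε)  (only finitely many variables occur).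
  record AffineForm : Set (c ⊔ ℓ) where
    constructor affine
    field
      constTerm : Fε
      coeffs    : List Fε

  linPart : ℕ → List Fε → Frac
  linPart i []       = 0ᶠ
  linPart i (a ∷ as) = (ιᶠ a *ᶠ (var (x i) , 𝟙)) +ᶠ linPart (ℕ.suc i) as

  ⟦_⟧ᴬ : AffineForm → Frac
  ⟦ affine c₀ cs ⟧ᴬ = ιᶠ c₀ +ᶠ linPart 0 cs

  record Mat (A : Set c) : Set c where
    constructor mat
    field
      m11 m12 m21 m22 : A

  _·ᶠ_ : Mat Frac → Mat Frac → Mat Frac
  mat a b c' d ·ᶠ mat e f g h =
    mat ((a *ᶠ e) +ᶠ (b *ᶠ g)) ((a *ᶠ f) +ᶠ (b *ᶠ h))
        ((c' *ᶠ e) +ᶠ (d *ᶠ g)) ((c' *ᶠ f) +ᶠ (d *ᶠ h))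

  Iᶠ : Mat Frac
  Iᶠ = mat 1ᶠ 0ᶠ 0ᶠ 1ᶠ

  Qᴬ : AffineForm → Mat Frac
  Qᴬ ℓ' = mat ⟦ ℓ' ⟧ᴬ 1ᶠ 1ᶠ 0ᶠ

  prodQ : ∀ {n} → Vec AffineForm n → Mat Frac
  prodQ []         = Iᶠ
  prodQ (ℓ' ∷ ls)  = Qᴬ ℓ' ·ᶠ prodQ ls

  Qᴾ : P → Mat P
  Qᴾ h = mat h 𝟙 𝟙 𝟘

  _MatEquals_ : Mat Frac → Mat P → Set (c ⊔ ℓ)
  mat a b c' d MatEquals mat e f g h =
    (a Equals e) × (b Equals f) × (c' Equals g) × (d Equals h)

  IsProductOfPrimQ : ℕ → Mat P → Set (c ⊔ ℓ)
  IsProductOfPrimQ n M = Σ (Vec AffineForm n) λ ls → prodQ ls MatEquals M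

  InO : ℕ → P → Set (c ⊔ ℓ)
  InO k g = ∃ λ (r : P) → g ≃ (εᴾ ^^ k) ⊗ r

  InQPlusO : P → ℕ → Mat P → Set (c ⊔ ℓ)
  InQPlusO h k (mat a b c' d) =
    ∃ λ (E : Mat P) →
      InO k (Mat.m11 E) × InO k (Mat.m12 E) × InO k (Mat.m21 E) × InO k (Mat.m22 E) ×
      (a ≃ h ⊕ Mat.m11 E) × (b ≃ 𝟙 ⊕ Mat.m12 E) ×
      (c' ≃ 𝟙 ⊕ Mat.m21 E) × (d ≃ 𝟘 ⊕ Mat.m22 E)

  sumε : ∀ {m} → ℕ → Vec Px m → P
  sumε i []       = 𝟘
  sumε i (g ∷ gs) = ((εᴾ ^^ i) ⊗ ιx g) ⊕ sumε (ℕ.suc i) gs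

  DegεLe : ℕ → P → Set (c ⊔ ℓ)
  DegεLe d g = ∃ λ (gs : Vec Px (ℕ.suc d)) → g ≃ sumε 0 gs

  ErrDegLe : ℕ → Mat P → Set (c ⊔ ℓ)
  ErrDegLe d (mat a b c' d') = DegεLe d a × DegεLe d b × DegεLe d c' × DegεLe d d'

module Submission where

-- With the
-- constant gadgets G₋ = diag(1/ε, -ε), G₊ = diag(1/ε, ε) and
-- Gₛ = Q(σε²)·diag(1, -1), products of 3, 4 and 4 primitive Q-matrices, the
-- product  H = G₋ · F · Gₛ · F · G₊  has 2n + 11 factors, and a direct
-- computation shows H ∈ Q(σ f²) + O(ε) with error degree ≤ 2·deg F + 4.
-- Taking σ = 1 and σ = -1 gives the two matrices of the theorem.
--
-- Entries of a product of primitive Q-matrices are fractions over 𝔽[ε], and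
-- 𝔽[ε, x] is only given by a presentation, so denominators cannot be
-- cancelled.  We therefore work with representations M = X/δ of fraction
-- matrices M by polynomial matrices X, in cross-multiplied form.

open import Level using (Level; _⊔_)
open import Algebra.Bundles using (CommutativeRing; RawRing)
open import Algebra.Structures using (IsCommutativeRing)
import Algebra.Solver.Ring
import Algebra.Solver.Ring.AlmostCommutativeRing as ACR
open import Data.Nat as ℕ using (ℕ; zero; suc)
import Data.Nat.Properties as ℕ
open import Data.Nat.Tactic.RingSolver using (solve-∀)
open import Data.Integer as ℤ using (ℤ; +_; -[1+_]; _⊖_)
import Data.Integer.Properties as ℤ
open import Data.Sign as Sign using (Sign)
open import Data.Maybe using (Maybe; just; nothing)
open import Data.Product using (Σ; _×_; _,_; proj₁; proj₂)
open import Data.Unit using (⊤; tt)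
import Data.List as List
open import Data.Vec using (Vec; []; _∷_; _++_)
import Data.Vec as Vec
open import Relation.Nullary using (¬_; yes; no)
open import Relation.Binary.PropositionalEquality as ≡ using (_≡_)
open import Defs

-- The coefficients are interpreted
-- by the canonical ring homomorphism ℤ → R, which we construct here.
module IntegerSolver {c ℓ} (R : CommutativeRing c ℓ) where
  open CommutativeRing R
  open import Algebra.Properties.Ring ring
    using (-‿involutive; -0#≈0#; -1*x≈-x; -‿distribʳ-*; -‿+-comm)
  open import Relation.Binary.Reasoning.Setoid setoid

  -- n ↦ n·1.  Defined so that 0 and 1 are sent to 0# and 1# on the nose:
  -- solver constants then evaluate to the ring's own 0# and 1#.
  ⟦_⟧ℕ : ℕ → Carrier
  ⟦ zero ⟧ℕ          = 0#
  ⟦ suc zero ⟧ℕ      = 1#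
  ⟦ suc (suc n) ⟧ℕ   = 1# + ⟦ suc n ⟧ℕ

  ⟦suc⟧ℕ : ∀ n → ⟦ suc n ⟧ℕ ≈ 1# + ⟦ n ⟧ℕ
  ⟦suc⟧ℕ zero    = sym (+-identityʳ 1#)
  ⟦suc⟧ℕ (suc n) = refl

  ⟦+⟧ℕ : ∀ m n → ⟦ m ℕ.+ n ⟧ℕ ≈ ⟦ m ⟧ℕ + ⟦ n ⟧ℕ
  ⟦+⟧ℕ zero    n = sym (+-identityˡ _)
  ⟦+⟧ℕ (suc m) n = begin
    ⟦ suc (m ℕ.+ n) ⟧ℕ          ≈⟨ ⟦suc⟧ℕ (m ℕ.+ n) ⟩
    1# + ⟦ m ℕ.+ n ⟧ℕ           ≈⟨ +-congˡ (⟦+⟧ℕ m n) ⟩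
    1# + (⟦ m ⟧ℕ + ⟦ n ⟧ℕ)      ≈⟨ +-assoc _ _ _ ⟨
    (1# + ⟦ m ⟧ℕ) + ⟦ n ⟧ℕ      ≈⟨ +-congʳ (⟦suc⟧ℕ m) ⟨
    ⟦ suc m ⟧ℕ + ⟦ n ⟧ℕ         ∎

  ⟦*⟧ℕ : ∀ m n → ⟦ m ℕ.* n ⟧ℕ ≈ ⟦ m ⟧ℕ * ⟦ n ⟧ℕ
  ⟦*⟧ℕ zero    n = sym (zeroˡ _)
  ⟦*⟧ℕ (suc m) n = begin
    ⟦ n ℕ.+ m ℕ.* n ⟧ℕ              ≈⟨ ⟦+⟧ℕ n (m ℕ.* n) ⟩
    ⟦ n ⟧ℕ + ⟦ m ℕ.* n ⟧ℕ           ≈⟨ +-cong (sym (*-identityˡ _)) (⟦*⟧ℕ m n) ⟩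
    1# * ⟦ n ⟧ℕ + ⟦ m ⟧ℕ * ⟦ n ⟧ℕ   ≈⟨ distribʳ _ _ _ ⟨
    (1# + ⟦ m ⟧ℕ) * ⟦ n ⟧ℕ          ≈⟨ *-congʳ (⟦suc⟧ℕ m) ⟨
    ⟦ suc m ⟧ℕ * ⟦ n ⟧ℕ             ∎

  ⟦_⟧ℤ : ℤ → Carrier
  ⟦ + n ⟧ℤ      = ⟦ n ⟧ℕ
  ⟦ -[1+ n ] ⟧ℤ = - ⟦ suc n ⟧ℕ

  cancel-1# : ∀ x y → (1# + x) + - (1# + y) ≈ x + - y
  cancel-1# x y = begin
    (1# + x) + - (1# + y)       ≈⟨ +-congˡ (-‿+-comm 1# y) ⟨
    (1# + x) + (- 1# + - y)     ≈⟨ +-assoc _ _ _ ⟩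
    1# + (x + (- 1# + - y))     ≈⟨ +-congˡ (+-assoc _ _ _) ⟨
    1# + ((x + - 1#) + - y)     ≈⟨ +-congˡ (+-congʳ (+-comm _ _)) ⟩
    1# + ((- 1# + x) + - y)     ≈⟨ +-congˡ (+-assoc _ _ _) ⟩
    1# + (- 1# + (x + - y))     ≈⟨ +-assoc _ _ _ ⟨
    (1# + - 1#) + (x + - y)     ≈⟨ +-congʳ (-‿inverseʳ 1#) ⟩
    0# + (x + - y)              ≈⟨ +-identityˡ _ ⟩
    x + - y                     ∎

  ⟦⊖⟧ : ∀ m n → ⟦ m ⊖ n ⟧ℤ ≈ ⟦ m ⟧ℕ + - ⟦ n ⟧ℕ
  ⟦⊖⟧ m zero = begin
    ⟦ m ⊖ 0 ⟧ℤ       ≡⟨ ≡.cong ⟦_⟧ℤ (ℤ.⊖-≥ {m} {0} ℕ.z≤n) ⟩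
    ⟦ m ⟧ℕ           ≈⟨ +-identityʳ _ ⟨
    ⟦ m ⟧ℕ + 0#      ≈⟨ +-congˡ -0#≈0# ⟨
    ⟦ m ⟧ℕ + - 0#    ∎
  ⟦⊖⟧ zero (suc n) = begin
    ⟦ 0 ⊖ suc n ⟧ℤ          ≡⟨ ≡.cong ⟦_⟧ℤ (ℤ.⊖-≤ {0} {suc n} ℕ.z≤n) ⟩
    - ⟦ suc n ⟧ℕ            ≈⟨ +-identityˡ _ ⟨
    0# + - ⟦ suc n ⟧ℕ       ∎
  ⟦⊖⟧ (suc m) (suc n) = begin
    ⟦ suc m ⊖ suc n ⟧ℤ                    ≡⟨ ≡.cong ⟦_⟧ℤ (ℤ.[1+m]⊖[1+n]≡m⊖n m n) ⟩
    ⟦ m ⊖ n ⟧ℤ                            ≈⟨ ⟦⊖⟧ m n ⟩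
    ⟦ m ⟧ℕ + - ⟦ n ⟧ℕ                     ≈⟨ cancel-1# _ _ ⟨
    (1# + ⟦ m ⟧ℕ) + - (1# + ⟦ n ⟧ℕ)       ≈⟨ +-cong (⟦suc⟧ℕ m) (-‿cong (⟦suc⟧ℕ n)) ⟨
    ⟦ suc m ⟧ℕ + - ⟦ suc n ⟧ℕ             ∎

  ⟦-⟧ℤ : ∀ i → ⟦ ℤ.- i ⟧ℤ ≈ - ⟦ i ⟧ℤ
  ⟦-⟧ℤ (+ zero)   = sym -0#≈0#
  ⟦-⟧ℤ (+ suc n)  = refl
  ⟦-⟧ℤ -[1+ n ]   = sym (-‿involutive _)

  ⟦+⟧ℤ : ∀ i j → ⟦ i ℤ.+ j ⟧ℤ ≈ ⟦ i ⟧ℤ + ⟦ j ⟧ℤ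
  ⟦+⟧ℤ (+ m)    (+ n)    = ⟦+⟧ℕ m n
  ⟦+⟧ℤ (+ m)    -[1+ n ] = ⟦⊖⟧ m (suc n)
  ⟦+⟧ℤ -[1+ m ] (+ n)    = trans (⟦⊖⟧ n (suc m)) (+-comm _ _)
  ⟦+⟧ℤ -[1+ m ] -[1+ n ] = begin
    - ⟦ suc (suc (m ℕ.+ n)) ⟧ℕ        ≡⟨ ≡.cong (λ k → - ⟦ suc k ⟧ℕ) (ℕ.+-suc m n) ⟨
    - ⟦ suc m ℕ.+ suc n ⟧ℕ            ≈⟨ -‿cong (⟦+⟧ℕ (suc m) (suc n)) ⟩
    - (⟦ suc m ⟧ℕ + ⟦ suc n ⟧ℕ)       ≈⟨ -‿+-comm _ _ ⟨
    - ⟦ suc m ⟧ℕ + - ⟦ suc n ⟧ℕ       ∎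

  -- Multiplicativity, via the sign/absolute-value decomposition of ℤ.
  ⟦_⟧± : Sign → Carrier
  ⟦ Sign.+ ⟧± = 1#
  ⟦ Sign.- ⟧± = - 1#

  ⟦*⟧± : ∀ s t → ⟦ s Sign.* t ⟧± ≈ ⟦ s ⟧± * ⟦ t ⟧±
  ⟦*⟧± Sign.+ t      = sym (*-identityˡ _)
  ⟦*⟧± Sign.- Sign.+ = sym (*-identityʳ _)
  ⟦*⟧± Sign.- Sign.- = begin
    1#               ≈⟨ -‿involutive _ ⟨
    - - 1#           ≈⟨ -‿cong (-1*x≈-x _) ⟨
    - (- 1# * 1#)    ≈⟨ -‿distribʳ-* _ _ ⟩
    - 1# * - 1#      ∎

  ⟦◃⟧ : ∀ s n → ⟦ s ℤ.◃ n ⟧ℤ ≈ ⟦ s ⟧± * ⟦ n ⟧ℕ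
  ⟦◃⟧ s      zero    = sym (zeroʳ _)
  ⟦◃⟧ Sign.+ (suc n) = sym (*-identityˡ _)
  ⟦◃⟧ Sign.- (suc n) = sym (-1*x≈-x _)

  ⟦*⟧ℤ : ∀ i j → ⟦ i ℤ.* j ⟧ℤ ≈ ⟦ i ⟧ℤ * ⟦ j ⟧ℤ
  ⟦*⟧ℤ i j = begin
    ⟦ s Sign.* t ℤ.◃ m ℕ.* n ⟧ℤ            ≈⟨ ⟦◃⟧ (s Sign.* t) (m ℕ.* n) ⟩
    ⟦ s Sign.* t ⟧± * ⟦ m ℕ.* n ⟧ℕ          ≈⟨ *-cong (⟦*⟧± s t) (⟦*⟧ℕ m n) ⟩
    (⟦ s ⟧± * ⟦ t ⟧±) * (⟦ m ⟧ℕ * ⟦ n ⟧ℕ)  ≈⟨ interchange _ _ _ _ ⟩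
    (⟦ s ⟧± * ⟦ m ⟧ℕ) * (⟦ t ⟧± * ⟦ n ⟧ℕ)  ≈⟨ *-cong (signAbs i) (signAbs j) ⟨
    ⟦ i ⟧ℤ * ⟦ j ⟧ℤ                        ∎
    where
    s = ℤ.sign i ; t = ℤ.sign j ; m = ℤ.∣ i ∣ ; n = ℤ.∣ j ∣
    open import Algebra.Properties.CommutativeSemigroup *-commutativeSemigroup
      using (interchange)
    signAbs : ∀ k → ⟦ k ⟧ℤ ≈ ⟦ ℤ.sign k ⟧± * ⟦ ℤ.∣ k ∣ ⟧ℕ
    signAbs k = trans (reflexive (≡.cong ⟦_⟧ℤ (≡.sym (ℤ.◃-inverse k))))
                      (⟦◃⟧ (ℤ.sign k) ℤ.∣ k ∣)

  private
    almostCommutativeRing : ACR.AlmostCommutativeRing c ℓ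
    almostCommutativeRing = ACR.fromCommutativeRing R

    homomorphism : ℤ.+-*-rawRing ACR.-Raw-AlmostCommutative⟶ almostCommutativeRing
    homomorphism = record
      { ⟦_⟧ = ⟦_⟧ℤ ; +-homo = ⟦+⟧ℤ ; *-homo = ⟦*⟧ℤ ; -‿homo = ⟦-⟧ℤ
      ; 0-homo = refl ; 1-homo = refl }

    coefficients≟ : ∀ i j → Maybe (⟦ i ⟧ℤ ≈ ⟦ j ⟧ℤ)
    coefficients≟ i j with i ℤ.≟ j
    ... | yes i≡j = just (reflexive (≡.cong ⟦_⟧ℤ i≡j))
    ... | no  _   = nothing

  open Algebra.Solver.Ring ℤ.+-*-rawRing almostCommutativeRing homomorphism coefficients≟ public

-- Polynomial expressions in the operations of a ring, stated once for an
-- arbitrary raw ring R.  Instantiated at 𝔽[ε, x₁, x₂, …] they define the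
-- matrices of the construction; instantiated at the solver's syntax they
-- let the ring solver verify identities between those matrices.
module RingFormulas {a ℓ} (R : RawRing a ℓ) where
  open RawRing R renaming (Carrier to A)

  infixl 6 _-_
  infixl 7 _·_
  infixr 7 _⊙_

  _-_ : A → A → A
  x - y = x + - y

  cube : A → A
  cube e = e * (e * (e * 1#))

  record M₂ : Set a where
    constructor mat₂
    field ₁₁ ₁₂ ₂₁ ₂₂ : A

  _·_ : M₂ → M₂ → M₂
  mat₂ a b c d · mat₂ a' b' c' d' =
    mat₂ (a * a' + b * c') (a * b' + b * d') (c * a' + d * c') (c * b' + d * d')

  _⊙_ : A → M₂ → M₂
  k ⊙ mat₂ a b c d = mat₂ (k * a) (k * b) (k * c) (k * d)

  I₂ : M₂
  I₂ = mat₂ 1# 0# 0# 1#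

  -- d · Q(n/d): the polynomial matrix representing Q(n/d) with scale d.
  Q̂ : A → A → M₂
  Q̂ n d = mat₂ n d d 0#

  -- Scaled versions of diag(1/ε, -ε) and diag(1/ε, ε), and the matrix
  -- Q(s ε²)·diag(1, -1) = [[s ε², -1], [1, 0]].
  D₋ D₊ : A → M₂
  D₋ e = mat₂ 1# 0# 0# (- (e * e))
  D₊ e = mat₂ 1# 0# 0# (e * e)

  Mₛ : A → A → M₂
  Mₛ e s = mat₂ (s * (e * e)) (- 1#) 1# 0#

  Fᵣ : A → A → A → A → A → A → M₂
  Fᵣ e f ra rb rc rd =
    mat₂ (f + cube e * ra) (1# + cube e * rb) (1# + cube e * rc) (0# + cube e * rd)

  -- The matrix produced by the construction from F = [[a, b], [c, d]],
  -- where k = (b - c)/e³:  it equals e⁻² · D₋ F Mₛ F D₊.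
  Hₛ : A → A → M₂ → A → M₂
  Hₛ e s (mat₂ a b c d) k =
    mat₂ (s * (a * a) + e * (a * k))
         (s * (e * e) * (a * b) + b * b - a * d)
         (c * c - a * d - s * (e * e) * (a * c))
         (- (e * e * ((c * (s * (e * e)) + d) * b - c * d)))

module TermRing {c ℓ} (𝔽 : Field c ℓ) (V : Set) where
  open Over 𝔽
  open Field 𝔽 using (_≈_; 0≉1)
    renaming (Carrier to K; _+_ to _+ᴷ_; _*_ to _*ᴷ_; -_ to -ᴷ_; 1# to 1ᴷ)
  private module 𝔽 = Field 𝔽

  ⊕-identityˡ : ∀ (p : Term V) → 𝟘 ⊕ p ≃ p
  ⊕-identityˡ p = ≃-trans (⊕-comm _ _) (⊕-idʳ p)

  ⊕-inverseˡ : ∀ (p : Term V) → (⊝ p) ⊕ p ≃ 𝟘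
  ⊕-inverseˡ p = ≃-trans (⊕-comm _ _) (⊕-invʳ p)

  ⊗-identityˡ : ∀ (p : Term V) → 𝟙 ⊗ p ≃ p
  ⊗-identityˡ p = ≃-trans (⊗-comm _ _) (⊗-idʳ p)

  distribˡ : ∀ (p q r : Term V) → p ⊗ (q ⊕ r) ≃ (p ⊗ q) ⊕ (p ⊗ r)
  distribˡ p q r =
    ≃-trans (⊗-comm _ _) (≃-trans (distribʳ q r p) (⊕-cong (⊗-comm _ _) (⊗-comm _ _)))

  isCommutativeRing : IsCommutativeRing (_≃_ {V}) _⊕_ _⊗_ ⊝_ 𝟘 𝟙
  isCommutativeRing = record
    { isRing = record
      { +-isAbelianGroup = record
        { isGroup = record
          { isMonoid = record
            { isSemigroup = record
              { isMagma = record
                { isEquivalence = record { refl = ≃-refl ; sym = ≃-sym ; trans = ≃-trans }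
                ; ∙-cong = ⊕-cong }
              ; assoc = ⊕-assoc }
            ; identity = ⊕-identityˡ , ⊕-idʳ }
          ; inverse = ⊕-inverseˡ , ⊕-invʳ
          ; ⁻¹-cong = ⊝-cong }
        ; comm = ⊕-comm }
      ; *-cong = ⊗-cong
      ; *-assoc = ⊗-assoc
      ; *-identity = ⊗-identityˡ , ⊗-idʳ
      ; distrib = distribˡ , (λ p q r → distribʳ q r p) }
    ; *-comm = ⊗-comm }

  commutativeRing : CommutativeRing c (c ⊔ ℓ)
  commutativeRing = record { isCommutativeRing = isCommutativeRing }

  open IntegerSolver commutativeRing public
    using (solve; _:=_; _:+_; _:*_; :-_; Polynomial; con)

  syntaxRing : ℕ → RawRing Level.zero Level.zero
  syntaxRing n = record
    { Carrier = Polynomial n ; _≈_ = _≡_ ; _+_ = _:+_ ; _*_ = _:*_ ; -_ = :-_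
    ; 0# = con (+ 0) ; 1# = con (+ 1) }

  evaluate : (V → K) → Term V → K
  evaluate ρ (con a) = a
  evaluate ρ (var v) = ρ v
  evaluate ρ (p ⊕ q) = evaluate ρ p +ᴷ evaluate ρ q
  evaluate ρ (p ⊗ q) = evaluate ρ p *ᴷ evaluate ρ q
  evaluate ρ (⊝ p)   = -ᴷ evaluate ρ p

  evaluate-cong : ∀ ρ {p q} → p ≃ q → evaluate ρ p ≈ evaluate ρ q
  evaluate-cong ρ ≃-refl            = 𝔽.refl
  evaluate-cong ρ (≃-sym h)         = 𝔽.sym (evaluate-cong ρ h)
  evaluate-cong ρ (≃-trans h h')    = 𝔽.trans (evaluate-cong ρ h) (evaluate-cong ρ h')
  evaluate-cong ρ (⊕-cong h h')     = 𝔽.+-cong (evaluate-cong ρ h) (evaluate-cong ρ h')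
  evaluate-cong ρ (⊗-cong h h')     = 𝔽.*-cong (evaluate-cong ρ h) (evaluate-cong ρ h')
  evaluate-cong ρ (⊝-cong h)        = 𝔽.-‿cong (evaluate-cong ρ h)
  evaluate-cong ρ (⊕-assoc p q r)   = 𝔽.+-assoc _ _ _
  evaluate-cong ρ (⊕-comm p q)      = 𝔽.+-comm _ _
  evaluate-cong ρ (⊕-idʳ p)         = 𝔽.+-identityʳ _
  evaluate-cong ρ (⊕-invʳ p)        = 𝔽.-‿inverseʳ _
  evaluate-cong ρ (⊗-assoc p q r)   = 𝔽.*-assoc _ _ _
  evaluate-cong ρ (⊗-comm p q)      = 𝔽.*-comm _ _
  evaluate-cong ρ (⊗-idʳ p)         = 𝔽.*-identityʳ _
  evaluate-cong ρ (distribʳ p q r)  = 𝔽.distribʳ _ _ _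
  evaluate-cong ρ (con-cong h)      = h
  evaluate-cong ρ (con-+ a b)       = 𝔽.refl
  evaluate-cong ρ (con-* a b)       = 𝔽.refl

  ≄𝟘-if-evaluates-to-1 : ∀ ρ {p} → evaluate ρ p ≈ 1ᴷ → ¬ (p ≃ 𝟘)
  ≄𝟘-if-evaluates-to-1 ρ {p} p↦1 p≃𝟘 =
    0≉1 (𝔽.trans (𝔽.sym (evaluate-cong ρ p≃𝟘)) p↦1)

module Development {c ℓ} (𝔽 : Field c ℓ) where
  open Over 𝔽
  open Field 𝔽 using () renaming (Carrier to K; 0# to 0ᴷ; 1# to 1ᴷ; -_ to -ᴷ_)
  open TermRing 𝔽 PVar
  open import Relation.Binary.Reasoning.Setoid (CommutativeRing.setoid commutativeRing)

  module ℙ = RingFormulas (CommutativeRing.rawRing commutativeRing)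
  module 𝕊 {n : ℕ} = RingFormulas (syntaxRing n)
  open ℙ using (M₂; mat₂; _·_; _⊙_; Q̂)
  open ℙ.M₂
  open 𝕊.M₂

  one zer : ∀ {n} → Polynomial n
  one = con (+ 1)
  zer = con (+ 0)

  -- Division by ε.  Every p ∈ 𝔽[ε, x] splits as  p = p|ε↦0 + ε · quotε p,
  -- and both parts are well defined on polynomials.

  ε↦0 : P → P
  ε↦0 (con a)     = con a
  ε↦0 (var ε)     = 𝟘
  ε↦0 (var (x i)) = var (x i)
  ε↦0 (p ⊕ q)     = ε↦0 p ⊕ ε↦0 q
  ε↦0 (p ⊗ q)     = ε↦0 p ⊗ ε↦0 q
  ε↦0 (⊝ p)       = ⊝ ε↦0 p

  ε↦0-cong : ∀ {p q} → p ≃ q → ε↦0 p ≃ ε↦0 q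
  ε↦0-cong ≃-refl           = ≃-refl
  ε↦0-cong (≃-sym h)        = ≃-sym (ε↦0-cong h)
  ε↦0-cong (≃-trans h h')   = ≃-trans (ε↦0-cong h) (ε↦0-cong h')
  ε↦0-cong (⊕-cong h h')    = ⊕-cong (ε↦0-cong h) (ε↦0-cong h')
  ε↦0-cong (⊗-cong h h')    = ⊗-cong (ε↦0-cong h) (ε↦0-cong h')
  ε↦0-cong (⊝-cong h)       = ⊝-cong (ε↦0-cong h)
  ε↦0-cong (⊕-assoc p q r)  = ⊕-assoc _ _ _
  ε↦0-cong (⊕-comm p q)     = ⊕-comm _ _
  ε↦0-cong (⊕-idʳ p)        = ⊕-idʳ _
  ε↦0-cong (⊕-invʳ p)       = ⊕-invʳ _
  ε↦0-cong (⊗-assoc p q r)  = ⊗-assoc _ _ _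
  ε↦0-cong (⊗-comm p q)     = ⊗-comm _ _
  ε↦0-cong (⊗-idʳ p)        = ⊗-idʳ _
  ε↦0-cong (distribʳ p q r) = distribʳ _ _ _
  ε↦0-cong (con-cong h)     = con-cong h
  ε↦0-cong (con-+ a b)      = con-+ a b
  ε↦0-cong (con-* a b)      = con-* a b

  quotε : P → P
  quotε (con a)     = 𝟘
  quotε (var ε)     = 𝟙
  quotε (var (x i)) = 𝟘
  quotε (p ⊕ q)     = quotε p ⊕ quotε q
  quotε (p ⊗ q)     = quotε p ⊗ q ⊕ ε↦0 p ⊗ quotε q
  quotε (⊝ p)       = ⊝ quotε p

  ε-split : ∀ p → p ≃ ε↦0 p ⊕ εᴾ ⊗ quotε p
  ε-split (con a)     = solve 2 (λ a e → a := a :+ e :* zer) ≃-refl (con a) εᴾ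
  ε-split (var ε)     = solve 1 (λ e → e := zer :+ e :* one) ≃-refl εᴾ
  ε-split (var (x i)) = solve 2 (λ a e → a := a :+ e :* zer) ≃-refl (var (x i)) εᴾ
  ε-split (p ⊕ q)     = ≃-trans (⊕-cong (ε-split p) (ε-split q))
    (solve 5 (λ p₀ p₁ q₀ q₁ e → (p₀ :+ e :* p₁) :+ (q₀ :+ e :* q₁) := (p₀ :+ q₀) :+ e :* (p₁ :+ q₁))
      ≃-refl (ε↦0 p) (quotε p) (ε↦0 q) (quotε q) εᴾ)
  ε-split (p ⊗ q)     = begin
    p ⊗ q                                               ≈⟨ ⊗-cong (ε-split p) ≃-refl ⟩
    (ε↦0 p ⊕ εᴾ ⊗ quotε p) ⊗ q                          ≈⟨ solve 4 (λ p₀ p₁ q e → (p₀ :+ e :* p₁) :* q := p₀ :* q :+ e :* (p₁ :* q)) ≃-refl (ε↦0 p) (quotε p) q εᴾ ⟩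
    ε↦0 p ⊗ q ⊕ εᴾ ⊗ (quotε p ⊗ q)                      ≈⟨ ⊕-cong (⊗-cong ≃-refl (ε-split q)) ≃-refl ⟩
    ε↦0 p ⊗ (ε↦0 q ⊕ εᴾ ⊗ quotε q) ⊕ εᴾ ⊗ (quotε p ⊗ q) ≈⟨ solve 5 (λ p₀ q₀ q₁ e r → p₀ :* (q₀ :+ e :* q₁) :+ e :* r := p₀ :* q₀ :+ e :* (r :+ p₀ :* q₁)) ≃-refl (ε↦0 p) (ε↦0 q) (quotε q) εᴾ (quotε p ⊗ q) ⟩
    ε↦0 p ⊗ ε↦0 q ⊕ εᴾ ⊗ quotε (p ⊗ q)                  ∎
  ε-split (⊝ p)       = ≃-trans (⊝-cong (ε-split p))
    (solve 3 (λ p₀ p₁ e → :- (p₀ :+ e :* p₁) := :- p₀ :+ e :* (:- p₁)) ≃-refl (ε↦0 p) (quotε p) εᴾ)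

  quotε-cong : ∀ {p q} → p ≃ q → quotε p ≃ quotε q
  quotε-cong ≃-refl         = ≃-refl
  quotε-cong (≃-sym h)      = ≃-sym (quotε-cong h)
  quotε-cong (≃-trans h h') = ≃-trans (quotε-cong h) (quotε-cong h')
  quotε-cong (⊕-cong h h')  = ⊕-cong (quotε-cong h) (quotε-cong h')
  quotε-cong (⊗-cong h h')  = ⊕-cong (⊗-cong (quotε-cong h) h') (⊗-cong (ε↦0-cong h) (quotε-cong h'))
  quotε-cong (⊝-cong h)     = ⊝-cong (quotε-cong h)
  quotε-cong (⊕-assoc p q r) = ⊕-assoc _ _ _
  quotε-cong (⊕-comm p q)   = ⊕-comm _ _
  quotε-cong (⊕-idʳ p)      = ⊕-idʳ _
  quotε-cong (⊕-invʳ p)     = ⊕-invʳ _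
  quotε-cong (⊗-assoc p q r) =
    solve 7 (λ p₁ q r p₀ q₁ q₀ r₁ → (p₁ :* q :+ p₀ :* q₁) :* r :+ (p₀ :* q₀) :* r₁
                                   := p₁ :* (q :* r) :+ p₀ :* (q₁ :* r :+ q₀ :* r₁))
      ≃-refl (quotε p) q r (ε↦0 p) (quotε q) (ε↦0 q) (quotε r)
  quotε-cong (⊗-comm p q)   = begin
    quotε p ⊗ q ⊕ ε↦0 p ⊗ quotε q                          ≈⟨ ⊕-cong (⊗-cong ≃-refl (ε-split q)) ≃-refl ⟩
    quotε p ⊗ (ε↦0 q ⊕ εᴾ ⊗ quotε q) ⊕ ε↦0 p ⊗ quotε q     ≈⟨ solve 5 (λ p₀ p₁ q₀ q₁ e → p₁ :* (q₀ :+ e :* q₁) :+ p₀ :* q₁ := q₁ :* (p₀ :+ e :* p₁) :+ q₀ :* p₁) ≃-refl (ε↦0 p) (quotε p) (ε↦0 q) (quotε q) εᴾ ⟩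
    quotε q ⊗ (ε↦0 p ⊕ εᴾ ⊗ quotε p) ⊕ ε↦0 q ⊗ quotε p     ≈⟨ ⊕-cong (⊗-cong ≃-refl (≃-sym (ε-split p))) ≃-refl ⟩
    quotε q ⊗ p ⊕ ε↦0 q ⊗ quotε p                          ∎
  quotε-cong (⊗-idʳ p)      = solve 2 (λ p₁ p₀ → p₁ :* one :+ p₀ :* zer := p₁) ≃-refl (quotε p) (ε↦0 p)
  quotε-cong (distribʳ p q r) =
    solve 6 (λ p₁ q₁ r p₀ q₀ r₁ → (p₁ :+ q₁) :* r :+ (p₀ :+ q₀) :* r₁
                                 := (p₁ :* r :+ p₀ :* r₁) :+ (q₁ :* r :+ q₀ :* r₁))
      ≃-refl (quotε p) (quotε q) r (ε↦0 p) (ε↦0 q) (quotε r)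
  quotε-cong (con-cong h)   = ≃-refl
  quotε-cong (con-+ a b)    = ≃-sym (⊕-idʳ _)
  quotε-cong (con-* a b)    = solve 2 (λ a b → zer := zer :* b :+ a :* zer) ≃-refl (con a) (con b)

  quotε-ε⊗ : ∀ X → quotε (εᴾ ⊗ X) ≃ X
  quotε-ε⊗ X = solve 2 (λ X q → one :* X :+ zer :* q := X) ≃-refl X (quotε X)

  quotε-ιx : ∀ (g : Px) → quotε (ιx g) ≃ 𝟘
  quotε-ιx (con a) = ≃-refl
  quotε-ιx (var i) = ≃-refl
  quotε-ιx (p ⊕ q) = ≃-trans (⊕-cong (quotε-ιx p) (quotε-ιx q)) (⊕-idʳ _)
  quotε-ιx (p ⊗ q) = ≃-trans (⊕-cong (⊗-cong (quotε-ιx p) ≃-refl) (⊗-cong ≃-refl (quotε-ιx q)))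
    (solve 2 (λ q p₀ → zer :* q :+ p₀ :* zer := zer) ≃-refl (ιx q) (ε↦0 (ιx p)))
  quotε-ιx (⊝ p)   = ≃-trans (⊝-cong (quotε-ιx p)) (solve 0 (:- zer := zer) ≃-refl)

  Cancellable : P → Set (c ⊔ ℓ)
  Cancellable κ = ∀ {X Y} → κ ⊗ X ≃ κ ⊗ Y → X ≃ Y

  ε-cancellable : Cancellable εᴾ
  ε-cancellable {X} {Y} h = ≃-trans (≃-sym (quotε-ε⊗ X)) (≃-trans (quotε-cong h) (quotε-ε⊗ Y))

  ⊗-cancellable : ∀ {κ κ'} → Cancellable κ → Cancellable κ' → Cancellable (κ ⊗ κ')
  ⊗-cancellable cκ cκ' h =
    cκ' (cκ (≃-trans (≃-sym (⊗-assoc _ _ _)) (≃-trans h (⊗-assoc _ _ _))))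

  InO₁-from-ε↦0 : ∀ {z h} → ε↦0 z ≃ ε↦0 h → InO 1 (z ⊕ ⊝ h)
  InO₁-from-ε↦0 {z} {h} z₀≃h₀ = quotε z ⊕ ⊝ quotε h , (begin
    z ⊕ ⊝ h                                                    ≈⟨ ⊕-cong (ε-split z) (⊝-cong (ε-split h)) ⟩
    (ε↦0 z ⊕ εᴾ ⊗ quotε z) ⊕ ⊝ (ε↦0 h ⊕ εᴾ ⊗ quotε h)          ≈⟨ ⊕-cong (⊕-cong z₀≃h₀ ≃-refl) ≃-refl ⟩
    (ε↦0 h ⊕ εᴾ ⊗ quotε z) ⊕ ⊝ (ε↦0 h ⊕ εᴾ ⊗ quotε h)          ≈⟨ solve 4 (λ h₀ e z₁ h₁ → (h₀ :+ e :* z₁) :+ :- (h₀ :+ e :* h₁) := (e :* one) :* (z₁ :+ :- h₁)) ≃-refl (ε↦0 h) εᴾ (quotε z) (quotε h) ⟩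
    (εᴾ ^^ 1) ⊗ (quotε z ⊕ ⊝ quotε h)                         ∎)

  Deg≤ : ℕ → P → Set (c ⊔ ℓ)
  Deg≤ zero    Z = Σ Px λ g → Z ≃ ιx g
  Deg≤ (suc d) Z = Σ Px λ g → Σ P λ Z' → Deg≤ d Z' × (Z ≃ ιx g ⊕ εᴾ ⊗ Z')

  sumε-shift : ∀ {m} i (gs : Vec Px m) → sumε (suc i) gs ≃ εᴾ ⊗ sumε i gs
  sumε-shift i []       = solve 1 (λ e → zer := e :* zer) ≃-refl εᴾ
  sumε-shift i (g ∷ gs) = ≃-trans (⊕-cong (⊗-assoc _ _ _) (sumε-shift (suc i) gs))
    (solve 3 (λ e a b → e :* a :+ e :* b := e :* (a :+ b)) ≃-refl εᴾ ((εᴾ ^^ i) ⊗ ιx g) (sumε (suc i) gs))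

  Deg≤⇒DegεLe : ∀ d {Z} → Deg≤ d Z → DegεLe d Z
  Deg≤⇒DegεLe zero    (g , Z≃g) =
    g ∷ [] , ≃-trans Z≃g (solve 1 (λ a → a := one :* a :+ zer) ≃-refl (ιx g))
  Deg≤⇒DegεLe (suc d) (g , Z' , Z'-deg , Z≃) with Deg≤⇒DegεLe d Z'-deg
  ... | gs , Z'≃ = g ∷ gs , ≃-trans Z≃ (⊕-cong (≃-sym (⊗-identityˡ _))
                              (≃-trans (⊗-cong ≃-refl Z'≃) (≃-sym (sumε-shift 0 gs))))

  DegεLe⇒Deg≤ : ∀ d {Z} → DegεLe d Z → Deg≤ d Z
  DegεLe⇒Deg≤ zero    (g ∷ [] , Z≃) =
    g , ≃-trans Z≃ (solve 1 (λ a → one :* a :+ zer := a) ≃-refl (ιx g))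
  DegεLe⇒Deg≤ (suc d) (g ∷ gs , Z≃) =
    g , sumε 0 gs , DegεLe⇒Deg≤ d (gs , ≃-refl) ,
    ≃-trans Z≃ (⊕-cong (⊗-identityˡ _) (sumε-shift 0 gs))

  Deg≤-cong : ∀ d {Z W} → Z ≃ W → Deg≤ d Z → Deg≤ d W
  Deg≤-cong zero    Z≃W (g , Z≃)          = g , ≃-trans (≃-sym Z≃W) Z≃
  Deg≤-cong (suc d) Z≃W (g , Z' , dZ' , Z≃) = g , Z' , dZ' , ≃-trans (≃-sym Z≃W) Z≃

  Deg≤-𝟘 : ∀ d → Deg≤ d 𝟘
  Deg≤-𝟘 zero    = con 0ᴷ , ≃-refl
  Deg≤-𝟘 (suc d) = con 0ᴷ , 𝟘 , Deg≤-𝟘 d , solve 1 (λ e → zer := zer :+ e :* zer) ≃-refl εᴾ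

  Deg≤-suc : ∀ d {Z} → Deg≤ d Z → Deg≤ (suc d) Z
  Deg≤-suc zero    (g , Z≃) =
    g , 𝟘 , Deg≤-𝟘 0 , ≃-trans Z≃ (solve 2 (λ a e → a := a :+ e :* zer) ≃-refl (ιx g) εᴾ)
  Deg≤-suc (suc d) (g , Z' , dZ' , Z≃) = g , Z' , Deg≤-suc d dZ' , Z≃

  Deg≤-raise : ∀ k d {Z} → Deg≤ d Z → Deg≤ (k ℕ.+ d) Z
  Deg≤-raise zero    d dZ = dZ
  Deg≤-raise (suc k) d dZ = Deg≤-suc (k ℕ.+ d) (Deg≤-raise k d dZ)

  Deg≤-mono : ∀ {d d' Z} → d ℕ.≤ d' → Deg≤ d Z → Deg≤ d' Z
  Deg≤-mono {d} {d'} {Z} d≤d' dZ =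
    ≡.subst (λ k → Deg≤ k Z) (ℕ.m∸n+n≡m d≤d') (Deg≤-raise (d' ℕ.∸ d) d dZ)

  Deg≤-⊕ : ∀ d {Z W} → Deg≤ d Z → Deg≤ d W → Deg≤ d (Z ⊕ W)
  Deg≤-⊕ zero    (g , Z≃) (h , W≃) = g ⊕ h , ⊕-cong Z≃ W≃
  Deg≤-⊕ (suc d) (g , Z' , dZ' , Z≃) (h , W' , dW' , W≃) =
    g ⊕ h , Z' ⊕ W' , Deg≤-⊕ d dZ' dW' ,
    ≃-trans (⊕-cong Z≃ W≃)
      (solve 5 (λ g h e z w → (g :+ e :* z) :+ (h :+ e :* w) := (g :+ h) :+ e :* (z :+ w))
        ≃-refl (ιx g) (ιx h) εᴾ Z' W')

  Deg≤-⊝ : ∀ d {Z} → Deg≤ d Z → Deg≤ d (⊝ Z)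
  Deg≤-⊝ zero    (g , Z≃)          = ⊝ g , ⊝-cong Z≃
  Deg≤-⊝ (suc d) (g , Z' , dZ' , Z≃) =
    ⊝ g , ⊝ Z' , Deg≤-⊝ d dZ' ,
    ≃-trans (⊝-cong Z≃) (solve 3 (λ g e z → :- (g :+ e :* z) := :- g :+ e :* (:- z)) ≃-refl (ιx g) εᴾ Z')

  Deg≤-scale : ∀ d (k : Px) {Z} → Deg≤ d Z → Deg≤ d (ιx k ⊗ Z)
  Deg≤-scale zero    k (g , Z≃)          = k ⊗ g , ⊗-cong ≃-refl Z≃
  Deg≤-scale (suc d) k (g , Z' , dZ' , Z≃) =
    k ⊗ g , ιx k ⊗ Z' , Deg≤-scale d k dZ' ,
    ≃-trans (⊗-cong ≃-refl Z≃)
      (solve 4 (λ k g e z → k :* (g :+ e :* z) := k :* g :+ e :* (k :* z)) ≃-refl (ιx k) (ιx g) εᴾ Z')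

  Deg≤-ε⊗ : ∀ d {Z} → Deg≤ d Z → Deg≤ (suc d) (εᴾ ⊗ Z)
  Deg≤-ε⊗ d {Z} dZ = con 0ᴷ , Z , dZ , solve 2 (λ e z → e :* z := zer :+ e :* z) ≃-refl εᴾ Z

  Deg≤-ε : Deg≤ 1 εᴾ
  Deg≤-ε = Deg≤-cong 1 (⊗-idʳ εᴾ) (Deg≤-ε⊗ 0 (con 1ᴷ , ≃-refl))

  Deg≤-⊗ : ∀ a b {Z W} → Deg≤ a Z → Deg≤ b W → Deg≤ (a ℕ.+ b) (Z ⊗ W)
  Deg≤-⊗ zero    b (g , Z≃) dW = Deg≤-cong b (⊗-cong (≃-sym Z≃) ≃-refl) (Deg≤-scale b g dW)
  Deg≤-⊗ (suc a) b {Z} {W} (g , Z' , dZ' , Z≃) dW =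
    Deg≤-cong (suc (a ℕ.+ b)) (≃-sym ZW≃)
      (Deg≤-⊕ (suc (a ℕ.+ b)) (Deg≤-raise (suc a) b (Deg≤-scale b g dW))
                              (Deg≤-ε⊗ (a ℕ.+ b) (Deg≤-⊗ a b dZ' dW)))
    where
    ZW≃ : Z ⊗ W ≃ ιx g ⊗ W ⊕ εᴾ ⊗ (Z' ⊗ W)
    ZW≃ = ≃-trans (⊗-cong Z≃ ≃-refl)
      (solve 4 (λ g e z w → (g :+ e :* z) :* w := g :* w :+ e :* (z :* w)) ≃-refl (ιx g) εᴾ Z' W)

  Deg≤-peel : ∀ d {W} → Deg≤ (suc d) (εᴾ ⊗ W) → Deg≤ d W
  Deg≤-peel d {W} (g , Z' , dZ' , εW≃) = Deg≤-cong d Z'≃W dZ'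
    where
    Z'≃W : Z' ≃ W
    Z'≃W = ≃-sym (≃-trans (≃-sym (quotε-ε⊗ W)) (≃-trans (quotε-cong εW≃)
             (≃-trans (⊕-cong (quotε-ιx g) (quotε-ε⊗ Z')) (⊕-identityˡ _))))

  -- Fractions representing polynomials up to a scale.
  -- F ∼[ δ ] g  says  F = g/δ,  written without division:  δ·num F = den F · g.

  infix 4 _∼[_]_ _≈[_]_ _≃ᴹ_

  _∼[_]_ : Frac → P → P → Set (c ⊔ ℓ)
  F ∼[ δ ] g = δ ⊗ proj₁ F ≃ proj₂ F ⊗ g

  ∼-+ : ∀ {F G δ g h} → F ∼[ δ ] g → G ∼[ δ ] h → (F +ᶠ G) ∼[ δ ] (g ⊕ h)
  ∼-+ {a , b} {c' , d} {δ} {g} {h} F∼ G∼ = begin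
    δ ⊗ (a ⊗ d ⊕ c' ⊗ b)            ≈⟨ solve 5 (λ δ a d c b → δ :* (a :* d :+ c :* b) := (δ :* a) :* d :+ (δ :* c) :* b) ≃-refl δ a d c' b ⟩
    (δ ⊗ a) ⊗ d ⊕ (δ ⊗ c') ⊗ b      ≈⟨ ⊕-cong (⊗-cong F∼ ≃-refl) (⊗-cong G∼ ≃-refl) ⟩
    (b ⊗ g) ⊗ d ⊕ (d ⊗ h) ⊗ b       ≈⟨ solve 4 (λ b g d h → (b :* g) :* d :+ (d :* h) :* b := (b :* d) :* (g :+ h)) ≃-refl b g d h ⟩
    (b ⊗ d) ⊗ (g ⊕ h)               ∎

  ∼-* : ∀ {F G δ δ' g h} → F ∼[ δ ] g → G ∼[ δ' ] h → (F *ᶠ G) ∼[ δ ⊗ δ' ] (g ⊗ h)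
  ∼-* {a , b} {c' , d} {δ} {δ'} {g} {h} F∼ G∼ = begin
    (δ ⊗ δ') ⊗ (a ⊗ c')           ≈⟨ solve 4 (λ δ δ' a c → (δ :* δ') :* (a :* c) := (δ :* a) :* (δ' :* c)) ≃-refl δ δ' a c' ⟩
    (δ ⊗ a) ⊗ (δ' ⊗ c')           ≈⟨ ⊗-cong F∼ G∼ ⟩
    (b ⊗ g) ⊗ (d ⊗ h)             ≈⟨ solve 4 (λ b g d h → (b :* g) :* (d :* h) := (b :* d) :* (g :* h)) ≃-refl b g d h ⟩
    (b ⊗ d) ⊗ (g ⊗ h)             ∎

  _≈[_]_ : Mat Frac → P → M₂ → Set (c ⊔ ℓ)
  M ≈[ δ ] X = (Mat.m11 M ∼[ δ ] ₁₁ X) × (Mat.m12 M ∼[ δ ] ₁₂ X) ×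
               (Mat.m21 M ∼[ δ ] ₂₁ X) × (Mat.m22 M ∼[ δ ] ₂₂ X)

  _≃ᴹ_ : M₂ → M₂ → Set (c ⊔ ℓ)
  X ≃ᴹ Y = (₁₁ X ≃ ₁₁ Y) × (₁₂ X ≃ ₁₂ Y) × (₂₁ X ≃ ₂₁ Y) × (₂₂ X ≃ ₂₂ Y)

  ·ᶠ-≈ : ∀ M N {δ δ' X Y} → M ≈[ δ ] X → N ≈[ δ' ] Y → (M ·ᶠ N) ≈[ δ ⊗ δ' ] (X · Y)
  ·ᶠ-≈ _ _ (a , b , c' , d) (e , f , g , h) =
    ∼-+ (∼-* a e) (∼-* b g) , ∼-+ (∼-* a f) (∼-* b h) ,
    ∼-+ (∼-* c' e) (∼-* d g) , ∼-+ (∼-* c' f) (∼-* d h)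

  ≈-resp : ∀ {M δ δ' X X'} → δ ≃ δ' → X ≃ᴹ X' → M ≈[ δ ] X → M ≈[ δ' ] X'
  ≈-resp {δ = δ} {δ'} δ≃ (e₁ , e₂ , e₃ , e₄) (h₁ , h₂ , h₃ , h₄) =
    resp e₁ h₁ , resp e₂ h₂ , resp e₃ h₃ , resp e₄ h₄
    where
    resp : ∀ {F g g'} → g ≃ g' → F ∼[ δ ] g → F ∼[ δ' ] g'
    resp g≃ F∼ = ≃-trans (⊗-cong (≃-sym δ≃) ≃-refl) (≃-trans F∼ (⊗-cong ≃-refl g≃))

  ≈-rescale : ∀ {M κ δ X} → Cancellable κ → M ≈[ κ ⊗ δ ] (κ ⊙ X) → M ≈[ δ ] X
  ≈-rescale {κ = κ} {δ} cκ (h₁ , h₂ , h₃ , h₄) = div h₁ , div h₂ , div h₃ , div h₄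
    where
    div : ∀ {F g} → F ∼[ κ ⊗ δ ] (κ ⊗ g) → F ∼[ δ ] g
    div {n , d} {g} F∼ = cκ (begin
      κ ⊗ (δ ⊗ n)     ≈⟨ ⊗-assoc _ _ _ ⟨
      (κ ⊗ δ) ⊗ n     ≈⟨ F∼ ⟩
      d ⊗ (κ ⊗ g)     ≈⟨ solve 3 (λ d κ g → d :* (κ :* g) := κ :* (d :* g)) ≃-refl d κ g ⟩
      κ ⊗ (d ⊗ g)     ∎)

  -- We cannot cancel denominators in 𝔽[ε, x] (that would need it to be an
  -- integral domain), so linearity is recorded in cross-multiplied form.

  Col : Set c
  Col = Frac × Frac

  e₁ e₂ : Col
  e₁ = 1ᶠ , 0ᶠ
  e₂ = 0ᶠ , 1ᶠ

  cols : Mat Frac → Col × Col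
  cols M = (Mat.m11 M , Mat.m21 M) , (Mat.m12 M , Mat.m22 M)

  stepQ : AffineForm → Col → Col
  stepQ ℓ' (w₁ , w₂) = (⟦ ℓ' ⟧ᴬ *ᶠ w₁) +ᶠ (1ᶠ *ᶠ w₂) , (1ᶠ *ᶠ w₁) +ᶠ (0ᶠ *ᶠ w₂)

  act : ∀ {n} → Vec AffineForm n → Col → Col
  act []         v = v
  act (ℓ' ∷ xs)  v = stepQ ℓ' (act xs v)

  actᶜ : ∀ {n} → Vec AffineForm n → Col × Col → Col × Col
  actᶜ xs (v , w) = act xs v , act xs w

  cols-prodQ : ∀ {n} (xs : Vec AffineForm n) → cols (prodQ xs) ≡ actᶜ xs (e₁ , e₂)
  cols-prodQ []        = ≡.refl
  cols-prodQ (ℓ' ∷ xs) = ≡.cong (λ (vw : Col × Col) → stepQ ℓ' (proj₁ vw) , stepQ ℓ' (proj₂ vw)) (cols-prodQ xs)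

  cols-prodQ-++ : ∀ {n m} (xs : Vec AffineForm n) (ys : Vec AffineForm m) →
    cols (prodQ (xs ++ ys)) ≡ actᶜ xs (cols (prodQ ys))
  cols-prodQ-++ []        ys = ≡.refl
  cols-prodQ-++ (ℓ' ∷ xs) ys = ≡.cong (λ (vw : Col × Col) → stepQ ℓ' (proj₁ vw) , stepQ ℓ' (proj₂ vw)) (cols-prodQ-++ xs ys)

  -- An expansion of the fraction F, as a function of the column
  -- (u₁/r₁ , u₂/r₂), of the form (u₁/r₁)·(A/E) + (u₂/r₂)·(B/E), where w
  -- is the common factor by which numerator and denominator were scaled.
  record Expansion (F : Frac) (u₁ r₁ u₂ r₂ w A B E : P) : Set (c ⊔ ℓ) where
    field
      X₁ X₂  : P
      num≃   : proj₁ F ≃ u₁ ⊗ X₁ ⊕ u₂ ⊗ X₂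
      den≃   : proj₂ F ≃ w ⊗ E
      r₁X₁≃  : r₁ ⊗ X₁ ≃ w ⊗ A
      r₂X₂≃  : r₂ ⊗ X₂ ≃ w ⊗ B

  -- R is linear: it has such an expansion at every column, with fixed
  -- A, B, E and a scaling factor that is trivial at integral columns.
  record Linear (R : Col → Frac) : Set (c ⊔ ℓ) where
    field
      A B E     : P
      weight    : P → P → P
      weight-𝟙  : weight 𝟙 𝟙 ≃ 𝟙
      expansion : ∀ u₁ r₁ u₂ r₂ →
        Expansion (R ((u₁ , r₁) , (u₂ , r₂))) u₁ r₁ u₂ r₂ (weight r₁ r₂) A B E

  linear-proj₁ : Linear proj₁
  linear-proj₁ = record
    { A = 𝟙 ; B = 𝟘 ; E = 𝟙 ; weight = λ r₁ r₂ → r₁ ; weight-𝟙 = ≃-refl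
    ; expansion = λ u₁ r₁ u₂ r₂ → record
      { X₁ = 𝟙 ; X₂ = 𝟘
      ; num≃  = solve 2 (λ u₁ u₂ → u₁ := u₁ :* one :+ u₂ :* zer) ≃-refl u₁ u₂
      ; den≃  = ≃-sym (⊗-idʳ r₁)
      ; r₁X₁≃ = ≃-refl
      ; r₂X₂≃ = solve 2 (λ r₁ r₂ → r₂ :* zer := r₁ :* zer) ≃-refl r₁ r₂ } }

  linear-proj₂ : Linear proj₂
  linear-proj₂ = record
    { A = 𝟘 ; B = 𝟙 ; E = 𝟙 ; weight = λ r₁ r₂ → r₂ ; weight-𝟙 = ≃-refl
    ; expansion = λ u₁ r₁ u₂ r₂ → record
      { X₁ = 𝟘 ; X₂ = 𝟙
      ; num≃  = solve 2 (λ u₁ u₂ → u₂ := u₁ :* zer :+ u₂ :* one) ≃-refl u₁ u₂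
      ; den≃  = ≃-sym (⊗-idʳ r₂)
      ; r₁X₁≃ = solve 2 (λ r₁ r₂ → r₁ :* zer := r₂ :* zer) ≃-refl r₁ r₂
      ; r₂X₂≃ = ≃-refl } }

  combine-cross : ∀ {r X₁ X₂ w₁ w₂ A₁ A₂ q₁ q₂ E₁ E₂} (k k' : P) →
    r ⊗ X₁ ≃ w₁ ⊗ A₁ → r ⊗ X₂ ≃ w₂ ⊗ A₂ → q₁ ≃ w₁ ⊗ E₁ → q₂ ≃ w₂ ⊗ E₂ →
    r ⊗ ((k ⊗ q₂) ⊗ X₁ ⊕ (k' ⊗ q₁) ⊗ X₂) ≃ (w₁ ⊗ w₂) ⊗ ((k ⊗ E₂) ⊗ A₁ ⊕ (k' ⊗ E₁) ⊗ A₂)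
  combine-cross {r} {X₁} {X₂} {w₁} {w₂} {A₁} {A₂} {q₁} {q₂} {E₁} {E₂} k k' rX₁ rX₂ q₁≃ q₂≃ = begin
    r ⊗ ((k ⊗ q₂) ⊗ X₁ ⊕ (k' ⊗ q₁) ⊗ X₂)
      ≈⟨ solve 7 (λ r k q₂ X₁ k' q₁ X₂ → r :* ((k :* q₂) :* X₁ :+ (k' :* q₁) :* X₂) := (k :* q₂) :* (r :* X₁) :+ (k' :* q₁) :* (r :* X₂)) ≃-refl r k q₂ X₁ k' q₁ X₂ ⟩
    (k ⊗ q₂) ⊗ (r ⊗ X₁) ⊕ (k' ⊗ q₁) ⊗ (r ⊗ X₂)
      ≈⟨ ⊕-cong (⊗-cong (⊗-cong ≃-refl q₂≃) rX₁) (⊗-cong (⊗-cong ≃-refl q₁≃) rX₂) ⟩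
    (k ⊗ (w₂ ⊗ E₂)) ⊗ (w₁ ⊗ A₁) ⊕ (k' ⊗ (w₁ ⊗ E₁)) ⊗ (w₂ ⊗ A₂)
      ≈⟨ solve 8 (λ k w₂ E₂ w₁ A₁ k' E₁ A₂ → (k :* (w₂ :* E₂)) :* (w₁ :* A₁) :+ (k' :* (w₁ :* E₁)) :* (w₂ :* A₂) := (w₁ :* w₂) :* ((k :* E₂) :* A₁ :+ (k' :* E₁) :* A₂)) ≃-refl k w₂ E₂ w₁ A₁ k' E₁ A₂ ⟩
    (w₁ ⊗ w₂) ⊗ ((k ⊗ E₂) ⊗ A₁ ⊕ (k' ⊗ E₁) ⊗ A₂) ∎

  linear-combine : ∀ {R₁ R₂} → Linear R₁ → Linear R₂ → ∀ (C C' : Frac) →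
    Linear (λ v → (C *ᶠ R₁ v) +ᶠ (C' *ᶠ R₂ v))
  linear-combine {R₁} {R₂} L₁ L₂ C@(n , d) C'@(n' , d') = record
    { A = A ; B = B ; E = E ; weight = weight ; weight-𝟙 = weight-𝟙 ; expansion = expansion }
    where
    module L₁ = Linear L₁
    module L₂ = Linear L₂
    k k' A B E : P
    k  = n ⊗ d'
    k' = n' ⊗ d
    A  = (k ⊗ L₂.E) ⊗ L₁.A ⊕ (k' ⊗ L₁.E) ⊗ L₂.A
    B  = (k ⊗ L₂.E) ⊗ L₁.B ⊕ (k' ⊗ L₁.E) ⊗ L₂.B
    E  = (d ⊗ d') ⊗ (L₁.E ⊗ L₂.E)
    weight : P → P → P
    weight r₁ r₂ = L₁.weight r₁ r₂ ⊗ L₂.weight r₁ r₂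
    weight-𝟙 : weight 𝟙 𝟙 ≃ 𝟙
    weight-𝟙 = ≃-trans (⊗-cong L₁.weight-𝟙 L₂.weight-𝟙) (⊗-idʳ 𝟙)
    expansion : ∀ u₁ r₁ u₂ r₂ →
      Expansion ((C *ᶠ R₁ ((u₁ , r₁) , (u₂ , r₂))) +ᶠ (C' *ᶠ R₂ ((u₁ , r₁) , (u₂ , r₂))))
                u₁ r₁ u₂ r₂ (weight r₁ r₂) A B E
    expansion u₁ r₁ u₂ r₂ = record
      { X₁ = (k ⊗ q₂) ⊗ Ex₁.X₁ ⊕ (k' ⊗ q₁) ⊗ Ex₂.X₁
      ; X₂ = (k ⊗ q₂) ⊗ Ex₁.X₂ ⊕ (k' ⊗ q₁) ⊗ Ex₂.X₂
      ; num≃ = ≃-trans (⊕-cong (⊗-cong (⊗-cong ≃-refl Ex₁.num≃) ≃-refl) (⊗-cong (⊗-cong ≃-refl Ex₂.num≃) ≃-refl))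
          (solve 12 (λ n d n' d' q₁ q₂ u₁ u₂ a b a' b' →
             (n :* (u₁ :* a :+ u₂ :* b)) :* (d' :* q₂) :+ (n' :* (u₁ :* a' :+ u₂ :* b')) :* (d :* q₁)
             := u₁ :* (((n :* d') :* q₂) :* a :+ ((n' :* d) :* q₁) :* a')
                :+ u₂ :* (((n :* d') :* q₂) :* b :+ ((n' :* d) :* q₁) :* b'))
            ≃-refl n d n' d' q₁ q₂ u₁ u₂ Ex₁.X₁ Ex₁.X₂ Ex₂.X₁ Ex₂.X₂)
      ; den≃ = ≃-trans (⊗-cong (⊗-cong ≃-refl Ex₁.den≃) (⊗-cong ≃-refl Ex₂.den≃))
          (solve 6 (λ d d' w₁ E₁ w₂ E₂ → (d :* (w₁ :* E₁)) :* (d' :* (w₂ :* E₂)) := (w₁ :* w₂) :* ((d :* d') :* (E₁ :* E₂)))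
            ≃-refl d d' (L₁.weight r₁ r₂) L₁.E (L₂.weight r₁ r₂) L₂.E)
      ; r₁X₁≃ = combine-cross k k' Ex₁.r₁X₁≃ Ex₂.r₁X₁≃ Ex₁.den≃ Ex₂.den≃
      ; r₂X₂≃ = combine-cross k k' Ex₁.r₂X₂≃ Ex₂.r₂X₂≃ Ex₁.den≃ Ex₂.den≃ }
      where
      q₁ q₂ : P
      q₁ = proj₂ (R₁ ((u₁ , r₁) , (u₂ , r₂)))
      q₂ = proj₂ (R₂ ((u₁ , r₁) , (u₂ , r₂)))
      module Ex₁ = Expansion (L₁.expansion u₁ r₁ u₂ r₂)
      module Ex₂ = Expansion (L₂.expansion u₁ r₁ u₂ r₂)

  linear-act : ∀ {n} (xs : Vec AffineForm n) →
    Linear (λ v → proj₁ (act xs v)) × Linear (λ v → proj₂ (act xs v))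
  linear-act []        = linear-proj₁ , linear-proj₂
  linear-act (ℓ' ∷ xs) with linear-act xs
  ... | L₁ , L₂ = linear-combine L₁ L₂ ⟦ ℓ' ⟧ᴬ 1ᶠ , linear-combine L₁ L₂ 1ᶠ 0ᶠ

  linear-eval : ∀ {R δ δ' ξ₁ ξ₂ Y₁ Y₂} → Linear R →
    R e₁ ∼[ δ ] ξ₁ → R e₂ ∼[ δ ] ξ₂ →
    ∀ v → proj₁ v ∼[ δ' ] Y₁ → proj₂ v ∼[ δ' ] Y₂ →
    R v ∼[ δ ⊗ δ' ] (ξ₁ ⊗ Y₁ ⊕ ξ₂ ⊗ Y₂)
  linear-eval {R} {δ} {δ'} {ξ₁} {ξ₂} {Y₁} {Y₂} L Re₁∼ Re₂∼ ((u₁ , r₁) , (u₂ , r₂)) u₁∼ u₂∼ = begin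
    (δ ⊗ δ') ⊗ proj₁ (R v)                         ≈⟨ ⊗-cong ≃-refl V.num≃ ⟩
    (δ ⊗ δ') ⊗ (u₁ ⊗ V.X₁ ⊕ u₂ ⊗ V.X₂)             ≈⟨ solve 6 (λ δ δ' u₁ X₁ u₂ X₂ → (δ :* δ') :* (u₁ :* X₁ :+ u₂ :* X₂) := δ :* ((δ' :* u₁) :* X₁ :+ (δ' :* u₂) :* X₂)) ≃-refl δ δ' u₁ V.X₁ u₂ V.X₂ ⟩
    δ ⊗ ((δ' ⊗ u₁) ⊗ V.X₁ ⊕ (δ' ⊗ u₂) ⊗ V.X₂)      ≈⟨ ⊗-cong ≃-refl (⊕-cong (⊗-cong u₁∼ ≃-refl) (⊗-cong u₂∼ ≃-refl)) ⟩
    δ ⊗ ((r₁ ⊗ Y₁) ⊗ V.X₁ ⊕ (r₂ ⊗ Y₂) ⊗ V.X₂)      ≈⟨ solve 7 (λ δ r₁ Y₁ X₁ r₂ Y₂ X₂ → δ :* ((r₁ :* Y₁) :* X₁ :+ (r₂ :* Y₂) :* X₂) := δ :* (Y₁ :* (r₁ :* X₁) :+ Y₂ :* (r₂ :* X₂))) ≃-refl δ r₁ Y₁ V.X₁ r₂ Y₂ V.X₂ ⟩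
    δ ⊗ (Y₁ ⊗ (r₁ ⊗ V.X₁) ⊕ Y₂ ⊗ (r₂ ⊗ V.X₂))      ≈⟨ ⊗-cong ≃-refl (⊕-cong (⊗-cong ≃-refl V.r₁X₁≃) (⊗-cong ≃-refl V.r₂X₂≃)) ⟩
    δ ⊗ (Y₁ ⊗ (w ⊗ L.A) ⊕ Y₂ ⊗ (w ⊗ L.B))          ≈⟨ solve 6 (λ δ Y₁ w A Y₂ B → δ :* (Y₁ :* (w :* A) :+ Y₂ :* (w :* B)) := w :* (Y₁ :* (δ :* A) :+ Y₂ :* (δ :* B))) ≃-refl δ Y₁ w L.A Y₂ L.B ⟩
    w ⊗ (Y₁ ⊗ (δ ⊗ L.A) ⊕ Y₂ ⊗ (δ ⊗ L.B))          ≈⟨ ⊗-cong ≃-refl (⊕-cong (⊗-cong ≃-refl δA≃) (⊗-cong ≃-refl δB≃)) ⟩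
    w ⊗ (Y₁ ⊗ (L.E ⊗ ξ₁) ⊕ Y₂ ⊗ (L.E ⊗ ξ₂))        ≈⟨ solve 6 (λ w Y₁ E ξ₁ Y₂ ξ₂ → w :* (Y₁ :* (E :* ξ₁) :+ Y₂ :* (E :* ξ₂)) := (w :* E) :* (ξ₁ :* Y₁ :+ ξ₂ :* Y₂)) ≃-refl w Y₁ L.E ξ₁ Y₂ ξ₂ ⟩
    (w ⊗ L.E) ⊗ (ξ₁ ⊗ Y₁ ⊕ ξ₂ ⊗ Y₂)                ≈⟨ ⊗-cong (≃-sym V.den≃) ≃-refl ⟩
    proj₂ (R v) ⊗ (ξ₁ ⊗ Y₁ ⊕ ξ₂ ⊗ Y₂)              ∎
    where
    module L = Linear L
    v : Col
    v = (u₁ , r₁) , (u₂ , r₂)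
    w : P
    w = L.weight r₁ r₂
    module V = Expansion (L.expansion u₁ r₁ u₂ r₂)

    -- At a unit column the weight is 1, so the expansion reads F = C/E.
    unit-weight : ∀ Z → L.weight 𝟙 𝟙 ⊗ Z ≃ Z
    unit-weight Z = ≃-trans (⊗-cong L.weight-𝟙 ≃-refl) (⊗-identityˡ Z)

    at-unit : ∀ {F X C ξ} → proj₁ F ≃ X → X ≃ L.weight 𝟙 𝟙 ⊗ C →
              proj₂ F ≃ L.weight 𝟙 𝟙 ⊗ L.E → F ∼[ δ ] ξ → δ ⊗ C ≃ L.E ⊗ ξ
    at-unit {F} {X} {C} {ξ} num≃ X≃ den≃ F∼ = begin
      δ ⊗ C                         ≈⟨ ⊗-cong ≃-refl (unit-weight C) ⟨
      δ ⊗ (L.weight 𝟙 𝟙 ⊗ C)        ≈⟨ ⊗-cong ≃-refl (≃-trans num≃ X≃) ⟨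
      δ ⊗ proj₁ F                   ≈⟨ F∼ ⟩
      proj₂ F ⊗ ξ                   ≈⟨ ⊗-cong (≃-trans den≃ (unit-weight L.E)) ≃-refl ⟩
      L.E ⊗ ξ                       ∎

    δA≃ : δ ⊗ L.A ≃ L.E ⊗ ξ₁
    δA≃ = at-unit (≃-trans E₁.num≃ (solve 2 (λ X₁ X₂ → one :* X₁ :+ zer :* X₂ := one :* X₁) ≃-refl E₁.X₁ E₁.X₂))
                  E₁.r₁X₁≃ E₁.den≃ Re₁∼
      where module E₁ = Expansion (L.expansion 𝟙 𝟙 𝟘 𝟙)

    δB≃ : δ ⊗ L.B ≃ L.E ⊗ ξ₂
    δB≃ = at-unit (≃-trans E₂.num≃ (solve 2 (λ X₁ X₂ → zer :* X₁ :+ one :* X₂ := one :* X₂) ≃-refl E₂.X₁ E₂.X₂))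
                  E₂.r₂X₂≃ E₂.den≃ Re₂∼
      where module E₂ = Expansion (L.expansion 𝟘 𝟙 𝟙 𝟙)

  ∼-along : ∀ {F G δ g} → F ≡ G → F ∼[ δ ] g → G ∼[ δ ] g
  ∼-along ≡.refl F∼ = F∼

  act-eval : ∀ {n} (xs : Vec AffineForm n) {δ δ' X Y₁ Y₂} → prodQ xs ≈[ δ ] X →
    ∀ v → proj₁ v ∼[ δ' ] Y₁ → proj₂ v ∼[ δ' ] Y₂ →
    (proj₁ (act xs v) ∼[ δ ⊗ δ' ] (₁₁ X ⊗ Y₁ ⊕ ₁₂ X ⊗ Y₂)) ×
    (proj₂ (act xs v) ∼[ δ ⊗ δ' ] (₂₁ X ⊗ Y₁ ⊕ ₂₂ X ⊗ Y₂))
  act-eval xs (x₁₁ , x₁₂ , x₂₁ , x₂₂) v Y₁∼ Y₂∼ =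
    linear-eval (proj₁ (linear-act xs)) (unit (λ vw → proj₁ (proj₁ vw)) x₁₁) (unit (λ vw → proj₁ (proj₂ vw)) x₁₂) v Y₁∼ Y₂∼ ,
    linear-eval (proj₂ (linear-act xs)) (unit (λ vw → proj₂ (proj₁ vw)) x₂₁) (unit (λ vw → proj₂ (proj₂ vw)) x₂₂) v Y₁∼ Y₂∼
    where
    unit : ∀ (select : Col × Col → Frac) {δ ξ} →
      select (cols (prodQ xs)) ∼[ δ ] ξ → select (actᶜ xs (e₁ , e₂)) ∼[ δ ] ξ
    unit select = ∼-along (≡.cong select (cols-prodQ xs))

  append : ∀ {n m} (xs : Vec AffineForm n) (ys : Vec AffineForm m) {δ δ' X Y} →
    prodQ xs ≈[ δ ] X → prodQ ys ≈[ δ' ] Y → prodQ (xs ++ ys) ≈[ δ ⊗ δ' ] (X · Y)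
  append xs ys {δ} {δ'} xs≈ (y₁₁ , y₁₂ , y₂₁ , y₂₂) =
    along (λ vw → proj₁ (proj₁ vw)) (proj₁ (act-eval xs xs≈ (proj₁ (cols (prodQ ys))) y₁₁ y₂₁)) ,
    along (λ vw → proj₁ (proj₂ vw)) (proj₁ (act-eval xs xs≈ (proj₂ (cols (prodQ ys))) y₁₂ y₂₂)) ,
    along (λ vw → proj₂ (proj₁ vw)) (proj₂ (act-eval xs xs≈ (proj₁ (cols (prodQ ys))) y₁₁ y₂₁)) ,
    along (λ vw → proj₂ (proj₂ vw)) (proj₂ (act-eval xs xs≈ (proj₂ (cols (prodQ ys))) y₁₂ y₂₂))
    where
    along : ∀ (select : Col × Col → Frac) {g} →
      select (actᶜ xs (cols (prodQ ys))) ∼[ δ ⊗ δ' ] g → select (cols (prodQ (xs ++ ys))) ∼[ δ ⊗ δ' ] g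
    along select = ∼-along (≡.cong select (≡.sym (cols-prodQ-++ xs ys)))

  constForm : Fε → AffineForm
  constForm c = affine c List.[]

  Q-const : ∀ c → Qᴬ (constForm c) ≈[ ιε (Fε.den c) ] Q̂ (ιε (Fε.num c)) (ιε (Fε.den c))
  Q-const (p / q ∣ _) =
    solve 2 (λ p q → q :* (p :* one :+ zer :* q) := (q :* one) :* p) ≃-refl (ιε p) (ιε q) ,
    solve 1 (λ q → q :* one := one :* q) ≃-refl (ιε q) ,
    solve 1 (λ q → q :* one := one :* q) ≃-refl (ιε q) ,
    solve 1 (λ q → q :* zer := one :* zer) ≃-refl (ιε q)

  Q̂∏ : ∀ {n} → Vec Fε n → M₂
  Q̂∏ []       = ℙ.I₂
  Q̂∏ (c ∷ cs) = Q̂ (ιε (Fε.num c)) (ιε (Fε.den c)) · Q̂∏ cs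

  den∏ : ∀ {n} → Vec Fε n → P
  den∏ []       = 𝟙
  den∏ (c ∷ cs) = ιε (Fε.den c) ⊗ den∏ cs

  prodQ-const : ∀ {n} (cs : Vec Fε n) → prodQ (Vec.map constForm cs) ≈[ den∏ cs ] Q̂∏ cs
  prodQ-const []       = ≃-refl , ≃-refl , ≃-refl , ≃-refl
  prodQ-const (c ∷ cs) =
    ·ᶠ-≈ (Qᴬ (constForm c)) (prodQ (Vec.map constForm cs)) (Q-const c) (prodQ-const cs)

  t : Pε
  t = var tt

  𝟙≄𝟘 : ¬ (𝟙 {⊤} ≃ 𝟘)
  𝟙≄𝟘 = TermRing.≄𝟘-if-evaluates-to-1 𝔽 ⊤ (λ _ → Field.1# 𝔽) (Field.refl 𝔽)

  t≄𝟘 : ¬ (t ≃ 𝟘)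
  t≄𝟘 = TermRing.≄𝟘-if-evaluates-to-1 𝔽 ⊤ (λ _ → Field.1# 𝔽) (Field.refl 𝔽)

  ⌜_⌝ _/ε : Pε → Fε
  ⌜ p ⌝ = p / 𝟙 ∣ 𝟙≄𝟘
  p /ε  = p / t ∣ t≄𝟘

  G₋ : Vec AffineForm 3
  G₋ = Vec.map constForm (𝟙 /ε ∷ ⌜ ⊝ t ⌝ ∷ 𝟙 /ε ∷ [])

  G₋-≈ : prodQ G₋ ≈[ εᴾ ] ℙ.D₋ εᴾ
  G₋-≈ = ≈-rescale ε-cancellable (≈-resp scale matrix (prodQ-const (𝟙 /ε ∷ ⌜ ⊝ t ⌝ ∷ 𝟙 /ε ∷ [])))
    where
    scale : εᴾ ⊗ (𝟙 ⊗ (εᴾ ⊗ 𝟙)) ≃ εᴾ ⊗ εᴾ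
    scale = solve 1 (λ e → e :* (one :* (e :* one)) := e :* e) ≃-refl εᴾ
    product : ∀ {n} → Polynomial n → 𝕊.M₂
    product e = 𝕊.Q̂ one e 𝕊.· (𝕊.Q̂ (:- e) one 𝕊.· (𝕊.Q̂ one e 𝕊.· 𝕊.I₂))
    target : ∀ {n} → Polynomial n → 𝕊.M₂
    target e = e 𝕊.⊙ 𝕊.D₋ e
    matrix : ℙ.Q̂ 𝟙 εᴾ · (ℙ.Q̂ (⊝ εᴾ) 𝟙 · (ℙ.Q̂ 𝟙 εᴾ · ℙ.I₂)) ≃ᴹ εᴾ ⊙ ℙ.D₋ εᴾ
    matrix = solve 1 (λ e → ₁₁ (product e) := ₁₁ (target e)) ≃-refl εᴾ ,
             solve 1 (λ e → ₁₂ (product e) := ₁₂ (target e)) ≃-refl εᴾ ,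
             solve 1 (λ e → ₂₁ (product e) := ₂₁ (target e)) ≃-refl εᴾ ,
             solve 1 (λ e → ₂₂ (product e) := ₂₂ (target e)) ≃-refl εᴾ

  G₊ : Vec AffineForm 4
  G₊ = Vec.map constForm ((𝟙 ⊕ ⊝ t) /ε ∷ ⌜ 𝟙 ⌝ ∷ ⌜ t ⊕ ⊝ 𝟙 ⌝ ∷ (⊝ 𝟙) /ε ∷ [])

  G₊-≈ : prodQ G₊ ≈[ εᴾ ] ℙ.D₊ εᴾ
  G₊-≈ = ≈-rescale ε-cancellable (≈-resp scale matrix
           (prodQ-const ((𝟙 ⊕ ⊝ t) /ε ∷ ⌜ 𝟙 ⌝ ∷ ⌜ t ⊕ ⊝ 𝟙 ⌝ ∷ (⊝ 𝟙) /ε ∷ [])))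
    where
    scale : εᴾ ⊗ (𝟙 ⊗ (𝟙 ⊗ (εᴾ ⊗ 𝟙))) ≃ εᴾ ⊗ εᴾ
    scale = solve 1 (λ e → e :* (one :* (one :* (e :* one))) := e :* e) ≃-refl εᴾ
    product : ∀ {n} → Polynomial n → 𝕊.M₂
    product e = 𝕊.Q̂ (one :+ :- e) e 𝕊.· (𝕊.Q̂ one one 𝕊.· (𝕊.Q̂ (e :+ :- one) one 𝕊.· (𝕊.Q̂ (:- one) e 𝕊.· 𝕊.I₂)))
    target : ∀ {n} → Polynomial n → 𝕊.M₂
    target e = e 𝕊.⊙ 𝕊.D₊ e
    matrix : ℙ.Q̂ (𝟙 ⊕ ⊝ εᴾ) εᴾ · (ℙ.Q̂ 𝟙 𝟙 · (ℙ.Q̂ (εᴾ ⊕ ⊝ 𝟙) 𝟙 · (ℙ.Q̂ (⊝ 𝟙) εᴾ · ℙ.I₂))) ≃ᴹ εᴾ ⊙ ℙ.D₊ εᴾ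
    matrix = solve 1 (λ e → ₁₁ (product e) := ₁₁ (target e)) ≃-refl εᴾ ,
             solve 1 (λ e → ₁₂ (product e) := ₁₂ (target e)) ≃-refl εᴾ ,
             solve 1 (λ e → ₂₁ (product e) := ₂₁ (target e)) ≃-refl εᴾ ,
             solve 1 (λ e → ₂₂ (product e) := ₂₂ (target e)) ≃-refl εᴾ

  -- Q(σε²) Q(1) Q(-1) Q(1) = Q(σε²) diag(1, -1) = Mₛ(ε, σ).
  Gₛ : K → Vec AffineForm 4
  Gₛ σ = Vec.map constForm (⌜ con σ ⊗ (t ⊗ t) ⌝ ∷ ⌜ 𝟙 ⌝ ∷ ⌜ ⊝ 𝟙 ⌝ ∷ ⌜ 𝟙 ⌝ ∷ [])

  Gₛ-≈ : ∀ σ → prodQ (Gₛ σ) ≈[ 𝟙 ] ℙ.Mₛ εᴾ (con σ)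
  Gₛ-≈ σ = ≈-resp scale matrix (prodQ-const (⌜ con σ ⊗ (t ⊗ t) ⌝ ∷ ⌜ 𝟙 ⌝ ∷ ⌜ ⊝ 𝟙 ⌝ ∷ ⌜ 𝟙 ⌝ ∷ []))
    where
    scale : 𝟙 ⊗ (𝟙 ⊗ (𝟙 ⊗ (𝟙 ⊗ 𝟙))) ≃ 𝟙
    scale = solve 0 (one :* (one :* (one :* (one :* one))) := one) ≃-refl
    product : ∀ {n} → Polynomial n → Polynomial n → 𝕊.M₂
    product e s = 𝕊.Q̂ (s :* (e :* e)) one 𝕊.· (𝕊.Q̂ one one 𝕊.· (𝕊.Q̂ (:- one) one 𝕊.· (𝕊.Q̂ one one 𝕊.· 𝕊.I₂)))
    matrix : ℙ.Q̂ (con σ ⊗ (εᴾ ⊗ εᴾ)) 𝟙 · (ℙ.Q̂ 𝟙 𝟙 · (ℙ.Q̂ (⊝ 𝟙) 𝟙 · (ℙ.Q̂ 𝟙 𝟙 · ℙ.I₂))) ≃ᴹ ℙ.Mₛ εᴾ (con σ)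
    matrix = solve 2 (λ e s → ₁₁ (product e s) := ₁₁ (𝕊.Mₛ e s)) ≃-refl εᴾ (con σ) ,
             solve 2 (λ e s → ₁₂ (product e s) := ₁₂ (𝕊.Mₛ e s)) ≃-refl εᴾ (con σ) ,
             solve 2 (λ e s → ₂₁ (product e s) := ₂₁ (𝕊.Mₛ e s)) ≃-refl εᴾ (con σ) ,
             solve 2 (λ e s → ₂₂ (product e s) := ₂₂ (𝕊.Mₛ e s)) ≃-refl εᴾ (con σ)

  InQPlusO-mod-ε : ∀ {h a b c' d} → ε↦0 a ≃ ε↦0 h → ε↦0 b ≃ 𝟙 → ε↦0 c' ≃ 𝟙 → ε↦0 d ≃ 𝟘 →
    InQPlusO h 1 (mat a b c' d)
  InQPlusO-mod-ε {h} {a} {b} {c'} {d} a≡h b≡1 c≡1 d≡0 =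
    mat (a ⊕ ⊝ h) (b ⊕ ⊝ 𝟙) (c' ⊕ ⊝ 𝟙) (d ⊕ ⊝ 𝟘) ,
    InO₁-from-ε↦0 a≡h , InO₁-from-ε↦0 b≡1 , InO₁-from-ε↦0 c≡1 , InO₁-from-ε↦0 d≡0 ,
    recombine a h , recombine b 𝟙 , recombine c' 𝟙 , recombine d 𝟘
    where
    recombine : ∀ z g → z ≃ g ⊕ (z ⊕ ⊝ g)
    recombine = solve 2 (λ z g → z := g :+ (z :+ :- g)) ≃-refl

  InQPlusO-cong : ∀ {h h' k} (M : Mat P) → h ≃ h' → InQPlusO h k M → InQPlusO h' k M
  InQPlusO-cong (mat _ _ _ _) h≃h' (E , o₁ , o₂ , o₃ , o₄ , e₁ , e₂ , e₃ , e₄) =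
    E , o₁ , o₂ , o₃ , o₄ , ≃-trans e₁ (⊕-cong h≃h' ≃-refl) , e₂ , e₃ , e₄

  toMat : M₂ → Mat P
  toMat X = mat (₁₁ X) (₁₂ X) (₂₁ X) (₂₂ X)

  ≈𝟙⇒MatEquals : ∀ {M X} → M ≈[ 𝟙 ] X → M MatEquals toMat X
  ≈𝟙⇒MatEquals (h₁ , h₂ , h₃ , h₄) = unscale h₁ , unscale h₂ , unscale h₃ , unscale h₄
    where
    unscale : ∀ {F g} → F ∼[ 𝟙 ] g → F Equals g
    unscale F∼ = ≃-trans (≃-sym (⊗-identityˡ _)) F∼

  MatEquals⇒≈𝟙 : ∀ {M a b c' d X} → M MatEquals mat a b c' d →
    a ≃ ₁₁ X → b ≃ ₁₂ X → c' ≃ ₂₁ X → d ≃ ₂₂ X → M ≈[ 𝟙 ] X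
  MatEquals⇒≈𝟙 (h₁ , h₂ , h₃ , h₄) e₁ e₂ e₃ e₄ = scale h₁ e₁ , scale h₂ e₂ , scale h₃ e₃ , scale h₄ e₄
    where
    scale : ∀ {F g g'} → F Equals g → g ≃ g' → F ∼[ 𝟙 ] g'
    scale F= g≃ = ≃-trans (⊗-identityˡ _) (≃-trans F= (⊗-cong ≃-refl g≃))

  length-eq : ∀ n → 3 ℕ.+ (n ℕ.+ (4 ℕ.+ (n ℕ.+ 4))) ≡ 2 ℕ.* n ℕ.+ 11
  length-eq = solve-∀

  ≤2e+4 : ∀ j e → j ℕ.≤ 4 → j ℕ.+ (e ℕ.+ e) ℕ.≤ 2 ℕ.* e ℕ.+ 4
  ≤2e+4 j e j≤4 = ℕ.≤-trans (ℕ.+-monoˡ-≤ (e ℕ.+ e) j≤4) (ℕ.≤-reflexive (4+2e e))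
    where
    4+2e : ∀ e → 4 ℕ.+ (e ℕ.+ e) ≡ 2 ℕ.* e ℕ.+ 4
    4+2e = solve-∀

  module Construction (σ : K) (f : Px) (ra rb rc rd : P) where
    s : P
    s = con σ

    F′ H : M₂
    F′ = ℙ.Fᵣ εᴾ (ιx f) ra rb rc rd
    H  = ℙ.Hₛ εᴾ s F′ (rb ℙ.- rc)

    F′ˢ : ∀ {n} (e f ra rb rc rd : Polynomial n) → 𝕊.M₂
    F′ˢ e f ra rb rc rd = 𝕊.Fᵣ e f ra rb rc rd
    Hˢ : ∀ {n} (e f ra rb rc rd s : Polynomial n) → 𝕊.M₂
    Hˢ e f ra rb rc rd s = 𝕊.Hₛ e s (F′ˢ e f ra rb rc rd) (rb 𝕊.- rc)
    productˢ : ∀ {n} (e f ra rb rc rd s : Polynomial n) → 𝕊.M₂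
    productˢ e f ra rb rc rd s =
      𝕊.D₋ e 𝕊.· (F′ˢ e f ra rb rc rd 𝕊.· (𝕊.Mₛ e s 𝕊.· (F′ˢ e f ra rb rc rd 𝕊.· 𝕊.D₊ e)))

    product : ℙ.D₋ εᴾ · (F′ · (ℙ.Mₛ εᴾ s · (F′ · ℙ.D₊ εᴾ))) ≃ᴹ (εᴾ ⊗ εᴾ) ⊙ H
    product =
      solve 7 (λ e f ra rb rc rd s → ₁₁ (productˢ e f ra rb rc rd s) := (e :* e) :* ₁₁ (Hˢ e f ra rb rc rd s)) ≃-refl εᴾ (ιx f) ra rb rc rd s ,
      solve 7 (λ e f ra rb rc rd s → ₁₂ (productˢ e f ra rb rc rd s) := (e :* e) :* ₁₂ (Hˢ e f ra rb rc rd s)) ≃-refl εᴾ (ιx f) ra rb rc rd s ,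
      solve 7 (λ e f ra rb rc rd s → ₂₁ (productˢ e f ra rb rc rd s) := (e :* e) :* ₂₁ (Hˢ e f ra rb rc rd s)) ≃-refl εᴾ (ιx f) ra rb rc rd s ,
      solve 7 (λ e f ra rb rc rd s → ₂₂ (productˢ e f ra rb rc rd s) := (e :* e) :* ₂₂ (Hˢ e f ra rb rc rd s)) ≃-refl εᴾ (ιx f) ra rb rc rd s

    realised : ∀ {n} (ls : Vec AffineForm n) → prodQ ls ≈[ 𝟙 ] F′ →
      prodQ (G₋ ++ (ls ++ (Gₛ σ ++ (ls ++ G₊)))) ≈[ 𝟙 ] H
    realised ls ls≈ =
      ≈-rescale (⊗-cancellable ε-cancellable ε-cancellable) (≈-resp scale product
        (append G₋ (ls ++ (Gₛ σ ++ (ls ++ G₊))) G₋-≈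
          (append ls (Gₛ σ ++ (ls ++ G₊)) ls≈
            (append (Gₛ σ) (ls ++ G₊) (Gₛ-≈ σ) (append ls G₊ ls≈ G₊-≈)))))
      where
      scale : εᴾ ⊗ (𝟙 ⊗ (𝟙 ⊗ (𝟙 ⊗ εᴾ))) ≃ (εᴾ ⊗ εᴾ) ⊗ 𝟙
      scale = solve 1 (λ e → e :* (one :* (one :* (one :* e))) := (e :* e) :* one) ≃-refl εᴾ

    in-Q-σf² : InQPlusO (s ⊗ (ιx f ⊗ ιx f)) 1 (toMat H)
    in-Q-σf² = InQPlusO-mod-ε
      (solve 6 (λ f ra rb rc rd s → ₁₁ (Hˢ zer f ra rb rc rd s) := s :* (f :* f)) ≃-refl f₀ ra₀ rb₀ rc₀ rd₀ s)
      (solve 6 (λ f ra rb rc rd s → ₁₂ (Hˢ zer f ra rb rc rd s) := one) ≃-refl f₀ ra₀ rb₀ rc₀ rd₀ s)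
      (solve 6 (λ f ra rb rc rd s → ₂₁ (Hˢ zer f ra rb rc rd s) := one) ≃-refl f₀ ra₀ rb₀ rc₀ rd₀ s)
      (solve 6 (λ f ra rb rc rd s → ₂₂ (Hˢ zer f ra rb rc rd s) := zer) ≃-refl f₀ ra₀ rb₀ rc₀ rd₀ s)
      where
      f₀ ra₀ rb₀ rc₀ rd₀ : P
      f₀ = ε↦0 (ιx f) ; ra₀ = ε↦0 ra ; rb₀ = ε↦0 rb ; rc₀ = ε↦0 rc ; rd₀ = ε↦0 rd

    degree : ∀ e → Deg≤ e (₁₁ F′) → Deg≤ e (₁₂ F′) → Deg≤ e (₂₁ F′) → Deg≤ e (₂₂ F′) →
      ErrDegLe (2 ℕ.* e ℕ.+ 4) (toMat H)
    degree e da db dc dd =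
      Deg≤⇒DegεLe _ (Deg≤-mono (≤2e+4 0 e ℕ.z≤n) H₁₁-deg) ,
      Deg≤⇒DegεLe _ (Deg≤-mono (≤2e+4 2 e (ℕ.s≤s (ℕ.s≤s ℕ.z≤n))) H₁₂-deg) ,
      Deg≤⇒DegεLe _ (Deg≤-mono (≤2e+4 2 e (ℕ.s≤s (ℕ.s≤s ℕ.z≤n))) H₂₁-deg) ,
      Deg≤⇒DegεLe _ (Deg≤-mono (≤2e+4 4 e ℕ.≤-refl) H₂₂-deg)
      where
      a b c' d : P
      a = ₁₁ F′ ; b = ₁₂ F′ ; c' = ₂₁ F′ ; d = ₂₂ F′
      ee : ℕ
      ee = e ℕ.+ e
      pad : ∀ {Z} → Deg≤ ee Z → Deg≤ (2 ℕ.+ ee) Z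
      pad = Deg≤-raise 2 ee
      sε² : Deg≤ 2 (s ⊗ (εᴾ ⊗ εᴾ))
      sε² = Deg≤-⊗ 0 2 (con σ , ≃-refl) (Deg≤-⊗ 1 1 Deg≤-ε Deg≤-ε)

      -- H₁₁ = (σ ε² a² + a (b - c)) / ε², whose numerator has degree ≤ 2 + 2e.
      ε²H₁₁≃ : εᴾ ⊗ (εᴾ ⊗ ₁₁ H) ≃ (s ⊗ (εᴾ ⊗ εᴾ)) ⊗ (a ⊗ a) ⊕ a ⊗ (b ⊕ ⊝ c')
      ε²H₁₁≃ = solve 7 (λ e f ra rb rc rd s →
        e :* (e :* ₁₁ (Hˢ e f ra rb rc rd s))
          := (s :* (e :* e)) :* (₁₁ (F′ˢ e f ra rb rc rd) :* ₁₁ (F′ˢ e f ra rb rc rd))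
             :+ ₁₁ (F′ˢ e f ra rb rc rd) :* (₁₂ (F′ˢ e f ra rb rc rd) :+ :- ₂₁ (F′ˢ e f ra rb rc rd)))
        ≃-refl εᴾ (ιx f) ra rb rc rd s
      H₁₁-deg : Deg≤ ee (₁₁ H)
      H₁₁-deg = Deg≤-peel ee (Deg≤-peel (suc ee) (Deg≤-cong (2 ℕ.+ ee) (≃-sym ε²H₁₁≃)
        (Deg≤-⊕ (2 ℕ.+ ee) (Deg≤-⊗ 2 ee sε² (Deg≤-⊗ e e da da))
                           (pad (Deg≤-⊗ e e da (Deg≤-⊕ e db (Deg≤-⊝ e dc)))))))

      H₁₂-deg : Deg≤ (2 ℕ.+ ee) (₁₂ H)
      H₁₂-deg = Deg≤-⊕ (2 ℕ.+ ee)
        (Deg≤-⊕ (2 ℕ.+ ee) (Deg≤-⊗ 2 ee sε² (Deg≤-⊗ e e da db)) (pad (Deg≤-⊗ e e db db)))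
        (pad (Deg≤-⊝ ee (Deg≤-⊗ e e da dd)))

      H₂₁-deg : Deg≤ (2 ℕ.+ ee) (₂₁ H)
      H₂₁-deg = Deg≤-⊕ (2 ℕ.+ ee)
        (Deg≤-⊕ (2 ℕ.+ ee) (pad (Deg≤-⊗ e e dc dc)) (pad (Deg≤-⊝ ee (Deg≤-⊗ e e da dd))))
        (Deg≤-⊝ (2 ℕ.+ ee) (Deg≤-⊗ 2 ee sε² (Deg≤-⊗ e e da dc)))

      H₂₂-deg : Deg≤ (4 ℕ.+ ee) (₂₂ H)
      H₂₂-deg = Deg≤-⊝ (4 ℕ.+ ee) (Deg≤-⊗ 2 (2 ℕ.+ ee) (Deg≤-⊗ 1 1 Deg≤-ε Deg≤-ε)
        (Deg≤-⊕ (2 ℕ.+ ee)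
          (Deg≤-⊗ (2 ℕ.+ e) e (Deg≤-⊕ (2 ℕ.+ e) csε² (Deg≤-raise 2 e dd)) db)
          (pad (Deg≤-⊝ ee (Deg≤-⊗ e e dc dd)))))
        where
        csε² : Deg≤ (2 ℕ.+ e) (c' ⊗ (s ⊗ (εᴾ ⊗ εᴾ)))
        csε² = Deg≤-cong (2 ℕ.+ e) (⊗-comm _ _) (Deg≤-⊗ 2 e sε² dc)

  σf²-reachable : (σ : K) (f : Px) (n : ℕ) (F : Mat P) →
    IsProductOfPrimQ n F → InQPlusO (ιx f) 3 F →
    Σ (Mat P) λ H → IsProductOfPrimQ (2 ℕ.* n ℕ.+ 11) H × InQPlusO (con σ ⊗ (ιx f ⊗ ιx f)) 1 H ×
      (∀ e → ErrDegLe e F → ErrDegLe (2 ℕ.* e ℕ.+ 4) H)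
  σf²-reachable σ f n (mat a b c' d) (ls , ls=F)
      (_ , (ra , E₁₁≃) , (rb , E₁₂≃) , (rc , E₂₁≃) , (rd , E₂₂≃) , a≃ , b≃ , c≃ , d≃) =
    toMat H ,
    ≡.subst (λ k → IsProductOfPrimQ k (toMat H)) (length-eq n)
      (G₋ ++ (ls ++ (Gₛ σ ++ (ls ++ G₊))) , ≈𝟙⇒MatEquals (realised ls ls≈)) ,
    in-Q-σf² ,
    λ e (da , db , dc , dd) → degree e (deg e a≃′ da) (deg e b≃′ db) (deg e c≃′ dc) (deg e d≃′ dd)
    where
    open Construction σ f ra rb rc rd
    a≃′ : a ≃ ₁₁ F′
    a≃′ = ≃-trans a≃ (⊕-cong ≃-refl E₁₁≃)
    b≃′ : b ≃ ₁₂ F′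
    b≃′ = ≃-trans b≃ (⊕-cong ≃-refl E₁₂≃)
    c≃′ : c' ≃ ₂₁ F′
    c≃′ = ≃-trans c≃ (⊕-cong ≃-refl E₂₁≃)
    d≃′ : d ≃ ₂₂ F′
    d≃′ = ≃-trans d≃ (⊕-cong ≃-refl E₂₂≃)
    ls≈ : prodQ ls ≈[ 𝟙 ] F′
    ls≈ = MatEquals⇒≈𝟙 ls=F a≃′ b≃′ c≃′ d≃′
    deg : ∀ e {z z'} → z ≃ z' → DegεLe e z → Deg≤ e z'
    deg e z≃z' dz = Deg≤-cong e z≃z' (DegεLe⇒Deg≤ e dz)

  con-1⊗ : ∀ X → con (-ᴷ 1ᴷ) ⊗ X ≃ ⊝ X
  con-1⊗ X = ≃-trans (⊗-cong con-1≃ ≃-refl) (solve 1 (λ X → :- one :* X := :- X) ≃-refl X)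
    where
    open import Algebra.Properties.Ring (CommutativeRing.ring commutativeRing) using (+-inverseʳ-unique)
    con-1≃ : con (-ᴷ 1ᴷ) ≃ ⊝ 𝟙
    con-1≃ = +-inverseʳ-unique 𝟙 (con (-ᴷ 1ᴷ))
               (≃-trans (≃-sym (con-+ 1ᴷ (-ᴷ 1ᴷ))) (con-cong (Field.-‿inverseʳ 𝔽 1ᴷ)))

open import Data.Nat using (_+_; _*_)

lemma3p3 : ∀ {c ℓ : Level} (𝔽 : Field c ℓ) → let open Over 𝔽 in
    (f : Px) (n : ℕ) (F : Mat P) →
    IsProductOfPrimQ n F → InQPlusO (ιx f) 3 F →
    Σ (Mat P) λ H → Σ (Mat P) λ H' →
    IsProductOfPrimQ (2 * n + 11) H × InQPlusO (ιx f ⊗ ιx f) 1 H ×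
    IsProductOfPrimQ (2 * n + 11) H' × InQPlusO (⊝ (ιx f ⊗ ιx f)) 1 H' ×
    (∀ (e : ℕ) → ErrDegLe e F → ErrDegLe (2 * e + 4) H × ErrDegLe (2 * e + 4) H')
lemma3p3 𝔽 f n F F-prod F∈ =
  let open Over 𝔽
      open Development 𝔽 using (σf²-reachable; InQPlusO-cong; con-1⊗)
      H₊ , H₊-prod , H₊∈ , H₊-deg = σf²-reachable (Field.1# 𝔽) f n F F-prod F∈
      H₋ , H₋-prod , H₋∈ , H₋-deg = σf²-reachable (Field.-_ 𝔽 (Field.1# 𝔽)) f n F F-prod F∈
  in H₊ , H₋ ,
     H₊-prod , InQPlusO-cong H₊ (TermRing.⊗-identityˡ 𝔽 PVar _) H₊∈ ,
     H₋-prod , InQPlusO-cong H₋ (con-1⊗ _) H₋∈ ,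
     λ e F-deg → H₊-deg e F-deg , H₋-deg e F-deg
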